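{- Let $k$ be a positive integer, $\omega=(\omega_1,\dots,\omega_k)\in\{0,1\}^k$, and let $J=J(\omega)$ be the set of integers $j$ ($1\le j\le k-1$) with $\omega_j=0$ and $\omega_{j+1}=1$. Let $\mu$ be a partition and $z$ a single variable. Then, as formal power series in $z$, \[ \sum_{\lambda} q^{n(\lambda)} z^{|\lambda|-|\mu|}\psi_{\lambda/\mu}(q) =\frac{q^{n(\mu)+\sum_{i=1}^k\mu'_i\omega_i} z^{\omega_1+\cdots+\omega_k}}{1-z}\bigl(1-z(1-\omega_k)q^{\mu'_k}\bigr)\prod_{j\in J}(1-q^{m_j(\mu)}), \] where the sum is over all partitions $\lambda\supset\mu$ such that $\lambda-\mu$ is a horizontal strip and $\lambda'_i-\mu'_i=\omega_i$ for $i=1,\dots,k$.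
   Context: For a partition $\lambda$: $\lambda'$ its conjugate, $|\lambda|$ its sum of parts, $m_i(\lambda)=\lambda'_i-\lambda'_{i+1}$ the multiplicity of $i$, $n(\lambda)=\sum_{i\ge1}(i-1)\lambda_i$. $\mu\subset\lambda$ means $\mu_i\le\lambda_i$ for all $i$; then $\lambda-\mu$ is a horizontal strip if $\theta'_i:=\lambda'_i-\mu'_i\in\{0,1\}$ for all $i$. For such a horizontal strip, $\psi_{\lambda/\mu}(q)=\prod_{j}(1-q^{m_j(\mu)})$, the product over all $j\ge1$ with $\theta'_j=0$ and $\theta'_{j+1}=1$. -}

module Defs where

open import Level using (Level)
open import Data.Bool using (Bool; true; false; if_then_else_; _∧_)
import Data.Nat as N
open import Data.Nat using (ℕ; zero; suc; _∸_; _≤ᵇ_; _≡ᵇ_; _≤?_)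
open import Data.List using (List; []; _∷_; map; foldr; upTo; length; filter; concatMap)
open import Data.Nat.ListAction using (sum)
open import Data.Vec using (Vec; toList)
open import Algebra.Bundles using (CommutativeRing)

-- A partition is a weakly decreasing list of naturals;
-- trailing zeros are allowed and are irrelevant (all notions below are
-- computed through the part function, which is 0 beyond the list).

_‼_ : List ℕ → ℕ → ℕ
[]       ‼ _       = 0
(x ∷ xs) ‼ zero    = x
(x ∷ xs) ‼ suc i   = xs ‼ i

-- λ_i, 1-indexed (i ≥ 1)
part : List ℕ → ℕ → ℕ
part la i = la ‼ (i ∸ 1)

allB : {A : Set} → (A → Bool) → List A → Bool
allB p = foldr (λ x b → p x ∧ b) true

data Decreasing : List ℕ → Set where
  dec-[]  : Decreasing []
  dec-[x] : ∀ x → Decreasing (x ∷ [])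
  dec-∷   : ∀ {x y xs} → y Data.Nat.≤ x → Decreasing (y ∷ xs) → Decreasing (x ∷ y ∷ xs)

IsPartition : List ℕ → Set
IsPartition = Decreasing

decreasingᵇ : List ℕ → Bool
decreasingᵇ []           = true
decreasingᵇ (x ∷ [])     = true
decreasingᵇ (x ∷ y ∷ xs) = (y ≤ᵇ x) ∧ decreasingᵇ (y ∷ xs)

size : List ℕ → ℕ
size = sum

conj : List ℕ → ℕ → ℕ
conj la i = length (filter (i ≤?_) la)

mult : List ℕ → ℕ → ℕ
mult la i = conj la i ∸ conj la (suc i)

nfun : List ℕ → ℕ
nfun la = go 0 la
  where
  go : ℕ → List ℕ → ℕ
  go _ []       = 0
  go i (x ∷ xs) = i N.* x N.+ go (suc i) xs

range1 : ℕ → List ℕ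
range1 n = map suc (upTo n)

-- a bound beyond which all parts and conjugate parts of μ and λ vanish
bound : List ℕ → List ℕ → ℕ
bound mu la = size mu N.+ size la N.+ length mu N.+ length la N.+ 2

containedᵇ : List ℕ → List ℕ → Bool
containedᵇ mu la = allB (λ i → part mu i ≤ᵇ part la i) (range1 (bound mu la))

θ' : List ℕ → List ℕ → ℕ → ℕ
θ' mu la i = conj la i ∸ conj mu i

hstripᵇ : List ℕ → List ℕ → Bool
hstripᵇ mu la = containedᵇ mu la ∧
  allB (λ i → (conj mu i ≤ᵇ conj la i) ∧ (conj la i ≤ᵇ suc (conj mu i)))
      (range1 (bound mu la))

b2n : Bool → ℕ
b2n true  = 1
b2n false = 0

ωat : ∀ {k} → Vec Bool k → ℕ → ℕ
ωat ω zero    = 0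
ωat ω (suc i) = toList (Data.Vec.map b2n ω) ‼ i

matchesᵇ : ∀ k → Vec Bool k → List ℕ → List ℕ → Bool
matchesᵇ k ω mu la = allB (λ i → θ' mu la i ≡ᵇ ωat ω i) (range1 k)

lists : ℕ → ℕ → List (List ℕ)
lists zero    M = [] ∷ []
lists (suc L) M = concatMap (λ x → map (x ∷_) (lists L M)) (upTo (suc M))

-- every partition of M (padded with zeros to length M) occurs exactly once here
candidates : ℕ → List (List ℕ)
candidates M = lists M M

module RingDefs {c ℓ : Level} (R : CommutativeRing c ℓ) where
  open CommutativeRing R

  pow : Carrier → ℕ → Carrier
  pow x zero    = 1#
  pow x (suc n) = x * pow x n

  sumR : List Carrier → Carrier
  sumR = foldr _+_ 0#

  prodR : List Carrier → Carrier
  prodR = foldr _*_ 1#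

  ψ : Carrier → List ℕ → List ℕ → Carrier
  ψ q la mu = prodR (map (λ j → if (θ' mu la j ≡ᵇ 0) ∧ (θ' mu la (suc j) ≡ᵇ 1)
                                  then 1# - pow q (mult mu j) else 1#)
                         (range1 (bound mu la)))

  Series : Set c
  Series = ℕ → Carrier

  _≈ₛ_ : Series → Series → Set ℓ
  f ≈ₛ g = ∀ n → f n ≈ g n

  _*ₛ_ : Series → Series → Series
  (f *ₛ g) n = sumR (map (λ i → f i * g (n ∸ i)) (upTo (suc n)))

  monomial : Carrier → ℕ → Series
  monomial a s n = if n ≡ᵇ s then a else 0#

  constS : Carrier → Series
  constS a = monomial a 0

  oneMinus : Carrier → Series
  oneMinus b zero          = 1#
  oneMinus b (suc zero)    = - b
  oneMinus b (suc (suc _)) = 0#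

  -- 1 / (1 - z) = Σ z^n
  geom : Series
  geom _ = 1#

  -- Coefficient of z^N: sum over partitions λ with |λ| = |μ| + N.
  lhs : Carrier → (k : ℕ) → Vec Bool k → List ℕ → Series
  lhs q k ω mu N =
    sumR (map (λ la → if decreasingᵇ la ∧ (size la ≡ᵇ (size mu N.+ N))
                          ∧ hstripᵇ mu la ∧ matchesᵇ k ω mu la
                       then pow q (nfun la) * ψ q la mu else 0#)
              (candidates (size mu N.+ N)))

  rhs : Carrier → (k : ℕ) → Vec Bool k → List ℕ → Series
  rhs q k ω mu =
    (((monomial (pow q (nfun mu N.+ sum (map (λ i → conj mu i N.* ωat ω i) (range1 k))))
                (sum (map (ωat ω) (range1 k))))
      *ₛ geom)
      *ₛ oneMinus ((1# - (if ωat ω k ≡ᵇ 1 then 1# else 0#)) * pow q (conj mu k)))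
      *ₛ constS (prodR (map (λ j → if (ωat ω j ≡ᵇ 0) ∧ (ωat ω (suc j) ≡ᵇ 1)
                                    then 1# - pow q (mult mu j) else 1#)
                            (range1 (k ∸ 1))))

{-# OPTIONS --safe #-}
-- A horizontal strip λ/μ is determined by its column vector θ' = λ' − μ' ∈ {0,1}^K: λ is the
-- conjugate of μ' + θ'. In these coordinates n(λ) = n(μ) + Σ_j θ'_j μ'_j and ψ_{λ/μ} is a product
-- of factors attached to adjacent columns, so q^{n(λ)} ψ_{λ/μ} factorises column by column. A 0/1
-- vector for which μ' + θ' is not a partition needs no exclusion: it has a column j with θ'_j = 0,
-- θ'_{j+1} = 1 and m_j(μ) = 0, whose factor 1 − q^0 vanishes. Fixing the first k columns to ω
-- splits off q^{n(μ) + Σ μ'_i ω_i} ∏_{j∈J} (1 − q^{m_j(μ)}) z^{|ω|}; the sum over the remaining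
-- 0/1 tails with m ones telescopes to 1 when m = 0 or ω_k = 1, and to 1 − q^{μ'_k} otherwise,
-- which are the coefficients of (1 − z(1 − ω_k) q^{μ'_k}) / (1 − z).
module Submission where

open import Defs
open import Level using (Level)
open import Data.Bool using (Bool)
open import Data.Nat using (ℕ; _≤_)
open import Data.List using (List)
open import Data.Vec using (Vec)
open import Algebra.Bundles using (CommutativeRing)

open import Data.Bool.Base using (true; false; if_then_else_; _∧_; T)
open import Data.Bool.Properties using (T-∧)
open import Data.Empty using (⊥-elim)
open import Data.List.Base using ([]; _∷_; _++_; map; length; upTo; applyUpTo; concatMap)
open import Data.List.Properties using (length-map; map-cong; map-cong-local; map-applyUpTo; ≡-dec)
open import Data.List.Relation.Unary.All as All using (All; []; _∷_)
open import Data.List.Relation.Unary.Any using (Any; here; there)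
open import Data.Nat.Base using (zero; suc; _<_; z≤n; s≤s; z<s; s<s; _≤ᵇ_; _≡ᵇ_)
open import Data.Nat.ListAction using (sum)
open import Data.Product.Base using (Σ; _×_; _,_; proj₁; proj₂)
open import Data.Unit.Base using (tt)
open import Function.Base using (_∘_)
open import Function.Bundles using (Equivalence)
open import Relation.Binary.PropositionalEquality as ≡ using (_≡_)
open import Relation.Nullary using (¬_; yes; no; does)

module Lists where
  open import Data.Nat.Base using (_+_)
  open import Data.Nat.Properties
  open import Algebra.Properties.CommutativeSemigroup +-commutativeSemigroup using (interchange)
  open import Data.List.Relation.Unary.All.Properties using (map⁺; concat⁺; all-upTo)
  open import Relation.Binary.PropositionalEquality

  range : ℕ → ℕ → List ℕ
  range i zero    = []
  range i (suc n) = i ∷ range (suc i) n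

  applyUpTo≡range : ∀ {f : ℕ → ℕ} i n → (∀ t → f t ≡ i + t) → applyUpTo f n ≡ range i n
  applyUpTo≡range i zero    f≗ = refl
  applyUpTo≡range i (suc n) f≗ = cong₂ _∷_ (trans (f≗ 0) (+-identityʳ i))
    (applyUpTo≡range (suc i) n (λ t → trans (f≗ (suc t)) (+-suc i t)))

  upTo≡range : ∀ n → upTo n ≡ range 0 n
  upTo≡range n = applyUpTo≡range 0 n (λ _ → refl)

  range1≡range : ∀ n → range1 n ≡ range 1 n
  range1≡range n = trans (map-applyUpTo (λ t → t) suc n) (applyUpTo≡range 1 n (λ _ → refl))

  length-range : ∀ i n → length (range i n) ≡ n
  length-range i zero    = refl
  length-range i (suc n) = cong suc (length-range (suc i) n)

  length-map-range : ∀ (f : ℕ → ℕ) i n → length (map f (range i n)) ≡ n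
  length-map-range f i n = trans (length-map f (range i n)) (length-range i n)

  range-++ : ∀ i m n → range i (m + n) ≡ range i m ++ range (i + m) n
  range-++ i zero    n = cong (λ j → range j n) (sym (+-identityʳ i))
  range-++ i (suc m) n = cong (i ∷_) (trans (range-++ (suc i) m n)
    (cong (λ j → range (suc i) m ++ range j n) (sym (+-suc i m))))

  All-range⁺ : ∀ {p} {P : ℕ → Set p} i n → (∀ {j} → i ≤ j → j < i + n → P j) → All P (range i n)
  All-range⁺ i zero    Pj = []
  All-range⁺ i (suc n) Pj = Pj ≤-refl (subst (i <_) (sym (+-suc i n)) (s≤s (m≤m+n i n)))
    ∷ All-range⁺ (suc i) n (λ {j} i<j j<i+n → Pj (<⇒≤ i<j) (subst (j <_) (sym (+-suc i n)) j<i+n))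

  All-range⁻ : ∀ {p} {P : ℕ → Set p} i n → All P (range i n) → ∀ {j} → i ≤ j → j < i + n → P j
  All-range⁻ i zero    []         i≤j j<i+0 = ⊥-elim (<⇒≱ j<i+0 (subst (_≤ _) (sym (+-identityʳ i)) i≤j))
  All-range⁻ i (suc n) (Pi ∷ Ps) {j} i≤j j<i+n with i ≟ j
  ... | yes refl = Pi
  ... | no  i≢j  = All-range⁻ (suc i) n Ps (≤∧≢⇒< i≤j i≢j) (subst (j <_) (+-suc i n) j<i+n)

  All-range1⁺ : ∀ {p} {P : ℕ → Set p} n → (∀ t → P (suc t)) → All P (range 1 n)
  All-range1⁺ n Pt = All-range⁺ 1 n λ { {zero} () _ ; {suc t} _ _ → Pt t }

  map-cong-range1 : ∀ {a} {A : Set a} {f g : ℕ → A} n → (∀ t → f (suc t) ≡ g (suc t)) → map f (range 1 n) ≡ map g (range 1 n)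
  map-cong-range1 n f≗g = map-cong-local (All-range1⁺ n f≗g)

  ‼-map-range : ∀ (f : ℕ → ℕ) i n {t} → t < n → map f (range i n) ‼ t ≡ f (i + t)
  ‼-map-range f i (suc n) {zero}  _         = cong f (sym (+-identityʳ i))
  ‼-map-range f i (suc n) {suc t} (s≤s t<n) = trans (‼-map-range f (suc i) n t<n) (cong f (sym (+-suc i t)))

  ‼-beyond : ∀ xs {t} → length xs ≤ t → xs ‼ t ≡ 0
  ‼-beyond []       _             = refl
  ‼-beyond (x ∷ xs) {suc t} (s≤s p) = ‼-beyond xs p

  ‼-bounded : ∀ {B xs} → All (_≤ B) xs → ∀ t → xs ‼ t ≤ B
  ‼-bounded []       t       = z≤n
  ‼-bounded (p ∷ ps) zero    = p
  ‼-bounded (p ∷ ps) (suc t) = ‼-bounded ps t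

  ‼-ext : ∀ {xs ys} → length xs ≡ length ys → (∀ t → xs ‼ t ≡ ys ‼ t) → xs ≡ ys
  ‼-ext {[]}     {[]}     _   _  = refl
  ‼-ext {x ∷ xs} {y ∷ ys} len eq = cong₂ _∷_ (eq 0) (‼-ext (suc-injective len) (eq ∘ suc))

  map-part-range : ∀ xs {n} → length xs ≡ n → map (part xs) (range 1 n) ≡ xs
  map-part-range xs {n} len = ‼-ext (trans (length-map-range (part xs) 1 n) (sym len)) lookup
    where
    lookup : ∀ t → map (part xs) (range 1 n) ‼ t ≡ xs ‼ t
    lookup t with t <? n
    ... | yes t<n = ‼-map-range (part xs) 1 n t<n
    ... | no  t≮n = trans (‼-beyond (map (part xs) (range 1 n)) (≤-trans (≤-reflexive (length-map-range (part xs) 1 n)) (≮⇒≥ t≮n)))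
                          (sym (‼-beyond xs (subst (_≤ t) (sym len) (≮⇒≥ t≮n))))

  allB⁻ : ∀ {A : Set} {p : A → Bool} xs → T (allB p xs) → All (T ∘ p) xs
  allB⁻         []       _   = []
  allB⁻ {p = p} (x ∷ xs) all = let px , pxs = Equivalence.to (T-∧ {p x}) all in px ∷ allB⁻ xs pxs

  allB⁺ : ∀ {A : Set} {p : A → Bool} {xs} → All (T ∘ p) xs → T (allB p xs)
  allB⁺         []               = tt
  allB⁺ {p = p} (_∷_ {x} px pxs) = Equivalence.from (T-∧ {p x}) (px , allB⁺ pxs)

  allB-range1⁻ : ∀ (p : ℕ → Bool) n → T (allB p (range1 n)) → ∀ {t} → t < n → T (p (suc t))
  allB-range1⁻ p n all t<n =
    All-range⁻ 1 n (subst (All (T ∘ p)) (range1≡range n) (allB⁻ {p = p} (range1 n) all)) (s≤s z≤n) (s≤s t<n)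

  allB-range1⁺ : ∀ (p : ℕ → Bool) n → (∀ {t} → t < n → T (p (suc t))) → T (allB p (range1 n))
  allB-range1⁺ p n pt = allB⁺ {p = p} (subst (All (T ∘ p)) (sym (range1≡range n))
    (All-range⁺ 1 n λ { {zero} () _ ; {suc t} _ (s≤s t<n) → pt t<n }))

  decreasingᵇ-sound : ∀ la → T (decreasingᵇ la) → Decreasing la
  decreasingᵇ-sound []           _   = dec-[]
  decreasingᵇ-sound (x ∷ [])     _   = dec-[x] x
  decreasingᵇ-sound (x ∷ y ∷ xs) dec = let y≤x , rest = Equivalence.to (T-∧ {y ≤ᵇ x}) dec in
    dec-∷ (≤ᵇ⇒≤ y x y≤x) (decreasingᵇ-sound (y ∷ xs) rest)

  decreasingᵇ-complete : ∀ {la} → Decreasing la → T (decreasingᵇ la)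
  decreasingᵇ-complete dec-[]                    = tt
  decreasingᵇ-complete (dec-[x] x)               = tt
  decreasingᵇ-complete (dec-∷ {x} {y} y≤x rest) =
    Equivalence.from (T-∧ {y ≤ᵇ x}) (≤⇒≤ᵇ y≤x , decreasingᵇ-complete rest)

  Decreasing-tail : ∀ {x xs} → Decreasing (x ∷ xs) → Decreasing xs
  Decreasing-tail (dec-[x] _)  = dec-[]
  Decreasing-tail (dec-∷ _ d) = d

  Decreasing-≤head : ∀ {x xs} → Decreasing (x ∷ xs) → All (_≤ x) xs
  Decreasing-≤head (dec-[x] _)     = []
  Decreasing-≤head (dec-∷ y≤x d) = y≤x ∷ All.map (λ z≤y → ≤-trans z≤y y≤x) (Decreasing-≤head d)

  map-range-decreasing : ∀ {f : ℕ → ℕ} → (∀ j → f (suc j) ≤ f j) → ∀ i n → Decreasing (map f (range i n))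
  map-range-decreasing f↓ i zero          = dec-[]
  map-range-decreasing f↓ i (suc zero)    = dec-[x] _
  map-range-decreasing f↓ i (suc (suc n)) = dec-∷ (f↓ i) (map-range-decreasing f↓ (suc i) (suc n))

  map-range-ascent : ∀ (f : ℕ → ℕ) i n → ¬ T (decreasingᵇ (map f (range i (suc n)))) →
                     Any (λ j → f j < f (suc j)) (range i n)
  map-range-ascent f i zero    ¬dec = ⊥-elim (¬dec tt)
  map-range-ascent f i (suc n) ¬dec with f (suc i) ≤? f i
  ... | no  f[i+1]≰f[i] = here (≰⇒> f[i+1]≰f[i])
  ... | yes f[i+1]≤f[i] = there (map-range-ascent f (suc i) n
          (λ dec → ¬dec (Equivalence.from (T-∧ {f (suc i) ≤ᵇ f i}) (≤⇒≤ᵇ f[i+1]≤f[i] , dec))))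

  sum-map-0 : ∀ {A : Set} {f : A → ℕ} xs → (∀ x → f x ≡ 0) → sum (map f xs) ≡ 0
  sum-map-0 []       f≡0 = refl
  sum-map-0 (x ∷ xs) f≡0 = cong₂ _+_ (f≡0 x) (sum-map-0 xs f≡0)

  sum-map-+ : ∀ {A : Set} (f g : A → ℕ) xs → sum (map (λ x → f x + g x) xs) ≡ sum (map f xs) + sum (map g xs)
  sum-map-+ f g []       = refl
  sum-map-+ f g (x ∷ xs) = trans (cong (f x + g x +_) (sum-map-+ f g xs)) (interchange (f x) (g x) _ _)

  InLists : ℕ → ℕ → List ℕ → Set
  InLists L M t = length t ≡ L × All (_≤ M) t

  All-lists : ∀ L M → All (InLists L M) (lists L M)
  All-lists zero    M = (refl , []) ∷ []
  All-lists (suc L) M = concat⁺ (map⁺ (All.map (λ x≤M → map⁺ (All.map (λ (len , t≤M) → cong suc len , ≤-pred x≤M ∷ t≤M)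
                                                                     (All-lists L M)))
                                               (all-upTo (suc M))))

  ≡ᵇ-comm : ∀ m n → (m ≡ᵇ n) ≡ (n ≡ᵇ m)
  ≡ᵇ-comm zero    zero    = refl
  ≡ᵇ-comm zero    (suc n) = refl
  ≡ᵇ-comm (suc m) zero    = refl
  ≡ᵇ-comm (suc m) (suc n) = ≡ᵇ-comm m n

  lastOr : ℕ → List ℕ → ℕ
  lastOr p []      = p
  lastOr p (x ∷ u) = lastOr x u

  lastOr-‼ : ∀ p u {n} → length u ≡ suc n → lastOr p u ≡ u ‼ n
  lastOr-‼ p (x ∷ [])    {zero}  _   = refl
  lastOr-‼ p (x ∷ y ∷ u) {suc n} len = lastOr-‼ x (y ∷ u) (suc-injective len)

  sum-bits≤length : ∀ {t} → All (_≤ 1) t → sum t ≤ length t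
  sum-bits≤length []         = z≤n
  sum-bits≤length (x≤1 ∷ t≤1) = +-mono-≤ x≤1 (sum-bits≤length t≤1)

  _≼ᵇ_ : List ℕ → List ℕ → Bool
  []      ≼ᵇ _       = true
  (_ ∷ _) ≼ᵇ []      = false
  (y ∷ u) ≼ᵇ (x ∷ b) = (y ≡ᵇ x) ∧ (u ≼ᵇ b)

  ≟-≼ᵇ : ∀ u b → length u ≡ length b → does (≡-dec _≟_ u b) ≡ u ≼ᵇ b
  ≟-≼ᵇ []      []      _   = refl
  ≟-≼ᵇ (y ∷ u) (x ∷ b) len = cong ((y ≡ᵇ x) ∧_) (≟-≼ᵇ u b (suc-injective len))

  ≼ᵇ-‼ : ∀ u b → T (u ≼ᵇ b) → ∀ {t} → t < length u → b ‼ t ≡ u ‼ t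
  ≼ᵇ-‼ (y ∷ u) (x ∷ b) u≼b {zero}  _ = let y≡x , _ = Equivalence.to (T-∧ {y ≡ᵇ x}) u≼b in sym (≡ᵇ⇒≡ y x y≡x)
  ≼ᵇ-‼ (y ∷ u) (x ∷ b) u≼b {suc t} (s≤s t<n) = ≼ᵇ-‼ u b (proj₂ (Equivalence.to (T-∧ {y ≡ᵇ x}) u≼b)) t<n

  ‼-≼ᵇ : ∀ u b → length u ≤ length b → (∀ {t} → t < length u → b ‼ t ≡ u ‼ t) → T (u ≼ᵇ b)
  ‼-≼ᵇ []      b       _         _  = tt
  ‼-≼ᵇ (y ∷ u) (x ∷ b) (s≤s len) eq =
    Equivalence.from (T-∧ {y ≡ᵇ x}) (≡⇒≡ᵇ y x (sym (eq z<s)) , ‼-≼ᵇ u b len (eq ∘ s<s))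

open Lists

module Conjugation where
  open import Data.Nat.Base using (_+_; _*_; _∸_; _⊓_)
  open import Data.Nat.Combinatorics using (_C_; nC1≡n; nCk+nC[k+1]≡[n+1]C[k+1])
  open import Data.Nat.Properties
  open import Algebra.Properties.CommutativeSemigroup +-commutativeSemigroup using (interchange)
  open import Data.List.Relation.Unary.All.Properties using (map⁺)
  open import Relation.Binary.PropositionalEquality
  open ≡-Reasoning

  𝟙[_≤_] : ℕ → ℕ → ℕ
  𝟙[ j ≤ x ] = if j ≤ᵇ x then 1 else 0

  𝟙-yes : ∀ {j x} → j ≤ x → 𝟙[ j ≤ x ] ≡ 1
  𝟙-yes {j} {x} j≤x with j ≤ᵇ x | ≤⇒≤ᵇ j≤x
  ... | true | _ = refl

  𝟙-no : ∀ {j x} → ¬ j ≤ x → 𝟙[ j ≤ x ] ≡ 0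
  𝟙-no {j} {x} j≰x with j ≤ᵇ x | ≤ᵇ⇒≤ j x
  ... | false | _     = refl
  ... | true  | sound = ⊥-elim (j≰x (sound tt))

  𝟙≤1 : ∀ j x → 𝟙[ j ≤ x ] ≤ 1
  𝟙≤1 j x with j ≤ᵇ x
  ... | true  = ≤-refl
  ... | false = z≤n

  𝟙-antitone : ∀ {j j'} x → j ≤ j' → 𝟙[ j' ≤ x ] ≤ 𝟙[ j ≤ x ]
  𝟙-antitone {j} {j'} x j≤j' with j' ≤? x
  ... | yes j'≤x = ≤-reflexive (trans (𝟙-yes j'≤x) (sym (𝟙-yes (≤-trans j≤j' j'≤x))))
  ... | no  j'≰x = ≤-trans (≤-reflexive (𝟙-no j'≰x)) z≤n

  𝟙-cong : ∀ {j x j' x'} → (j ≤ x → j' ≤ x') → (j' ≤ x' → j ≤ x) → 𝟙[ j ≤ x ] ≡ 𝟙[ j' ≤ x' ]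
  𝟙-cong {j} {x} {j'} {x'} to from with j ≤? x
  ... | yes j≤x = trans (𝟙-yes j≤x) (sym (𝟙-yes (to j≤x)))
  ... | no  j≰x = trans (𝟙-no j≰x) (sym (𝟙-no (j≰x ∘ from)))

  conj-∷ : ∀ x xs j → conj (x ∷ xs) j ≡ 𝟙[ j ≤ x ] + conj xs j
  conj-∷ x xs j with j ≤ᵇ x
  ... | true  = refl
  ... | false = refl

  conj-≤-length : ∀ la j → conj la j ≤ length la
  conj-≤-length []       j = z≤n
  conj-≤-length (x ∷ xs) j = subst (_≤ _) (sym (conj-∷ x xs j)) (+-mono-≤ (𝟙≤1 j x) (conj-≤-length xs j))

  conj-antitone : ∀ la {j j'} → j ≤ j' → conj la j' ≤ conj la j
  conj-antitone []       j≤j' = z≤n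
  conj-antitone (x ∷ xs) {j} {j'} j≤j' rewrite conj-∷ x xs j | conj-∷ x xs j' =
    +-mono-≤ (𝟙-antitone x j≤j') (conj-antitone xs j≤j')

  conj-vanishes : ∀ {B la} → All (_≤ B) la → ∀ {j} → B < j → conj la j ≡ 0
  conj-vanishes                []                       B<j = refl
  conj-vanishes {la = x ∷ xs} (x≤B ∷ xs≤B) {j} B<j = begin
    conj (x ∷ xs) j        ≡⟨ conj-∷ x xs j ⟩
    𝟙[ j ≤ x ] + conj xs j ≡⟨ cong₂ _+_ (𝟙-no (λ j≤x → <⇒≱ B<j (≤-trans j≤x x≤B))) (conj-vanishes xs≤B B<j) ⟩
    0                      ∎

  <‼⇒<conj : ∀ {la} → Decreasing la → ∀ i j → j < la ‼ i → i < conj la (suc j)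
  <‼⇒<conj {[]}     d i       j ()
  <‼⇒<conj {x ∷ xs} d zero    j j<x    rewrite conj-∷ x xs (suc j) | 𝟙-yes j<x = s≤s z≤n
  <‼⇒<conj {x ∷ xs} d (suc i) j j<xs‼i rewrite conj-∷ x xs (suc j)
    | 𝟙-yes (≤-trans j<xs‼i (‼-bounded (Decreasing-≤head d) i)) = s≤s (<‼⇒<conj (Decreasing-tail d) i j j<xs‼i)

  <conj⇒<‼ : ∀ {la} → Decreasing la → ∀ i j → i < conj la (suc j) → j < la ‼ i
  <conj⇒<‼ {[]}     d i j ()
  <conj⇒<‼ {x ∷ xs} d i j i<conj with suc j ≤? x
  <conj⇒<‼ {x ∷ xs} d zero    j _      | yes j<x = j<x
  <conj⇒<‼ {x ∷ xs} d (suc i) j i<conj | yes j<x = <conj⇒<‼ (Decreasing-tail d) i j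
    (≤-pred (subst (suc i <_) (trans (conj-∷ x xs (suc j)) (cong (_+ _) (𝟙-yes j<x))) i<conj))
  <conj⇒<‼ {x ∷ xs} d i j i<conj | no j≮x = ⊥-elim (n≮0 (subst (i <_) conj≡0 i<conj))
    where
    conj≡0 : conj (x ∷ xs) (suc j) ≡ 0
    conj≡0 = trans (conj-∷ x xs (suc j)) (cong₂ _+_ (𝟙-no j≮x) (conj-vanishes (Decreasing-≤head d) (≰⇒> j≮x)))

  ≤-from-< : ∀ {m n} → (∀ {j} → j < m → j < n) → m ≤ n
  ≤-from-< {zero}  _    = z≤n
  ≤-from-< {suc m} m<⇒n< = m<⇒n< ≤-refl

  conj-≤⇒‼-≤ : ∀ {xs ys} → Decreasing xs → Decreasing ys →
               (∀ j → conj xs (suc j) ≤ conj ys (suc j)) → ∀ i → xs ‼ i ≤ ys ‼ i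
  conj-≤⇒‼-≤ dx dy le i = ≤-from-< λ {j} j<xs‼i →
    <conj⇒<‼ dy i j (<-≤-trans (<‼⇒<conj dx i j j<xs‼i) (le j))

  conj-injective : ∀ {xs ys} → Decreasing xs → Decreasing ys → length xs ≡ length ys →
                   (∀ j → conj xs (suc j) ≡ conj ys (suc j)) → xs ≡ ys
  conj-injective dx dy len eq = ‼-ext len λ i →
    ≤-antisym (conj-≤⇒‼-≤ dx dy (≤-reflexive ∘ eq) i) (conj-≤⇒‼-≤ dy dx (≤-reflexive ∘ sym ∘ eq) i)

  conjugate : ℕ → List ℕ → List ℕ
  conjugate n la = map (conj la) (range 1 n)

  length-conjugate : ∀ n la → length (conjugate n la) ≡ n
  length-conjugate n la = length-map-range (conj la) 1 n

  conjugate-decreasing : ∀ n la → Decreasing (conjugate n la)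
  conjugate-decreasing n la = map-range-decreasing (λ j → conj-antitone la (n≤1+n j)) 1 n

  conjugate-bounded : ∀ n la → All (_≤ length la) (conjugate n la)
  conjugate-bounded n la = map⁺ (All.universal (conj-≤-length la) (range 1 n))

  conj-suc≤size : ∀ la j → conj la (suc j) ≤ size la
  conj-suc≤size []       j = z≤n
  conj-suc≤size (x ∷ xs) j = subst (_≤ x + size xs) (sym (conj-∷ x xs (suc j))) (+-mono-≤ 𝟙≤x (conj-suc≤size xs j))
    where
    𝟙≤x : 𝟙[ suc j ≤ x ] ≤ x
    𝟙≤x with suc j ≤? x
    ... | yes j<x = ≤-trans (≤-reflexive (𝟙-yes j<x)) (≤-trans (s≤s z≤n) j<x)
    ... | no  j≮x = ≤-trans (≤-reflexive (𝟙-no j≮x)) z≤n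

  conj-map : ∀ (g : ℕ → ℕ) xs j → conj (map g xs) j ≡ sum (map (λ r → 𝟙[ j ≤ g r ]) xs)
  conj-map g []       j = refl
  conj-map g (x ∷ xs) j = trans (conj-∷ (g x) (map g xs) j) (cong (𝟙[ j ≤ g x ] +_) (conj-map g xs j))

  sum-𝟙-range : ∀ x i n → sum (map (λ r → 𝟙[ r ≤ x ]) (range (suc i) n)) ≡ (x ∸ i) ⊓ n
  sum-𝟙-range x i zero = sym (⊓-zeroʳ (x ∸ i))
  sum-𝟙-range x i (suc n) with suc i ≤? x
  ... | yes i<x = begin
    𝟙[ suc i ≤ x ] + sum (map (λ r → 𝟙[ r ≤ x ]) (range (suc (suc i)) n)) ≡⟨ cong₂ _+_ (𝟙-yes i<x) (sum-𝟙-range x (suc i) n) ⟩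
    suc ((x ∸ suc i) ⊓ n)                                                  ≡⟨ cong (_⊓ suc n) (+-∸-assoc 1 i<x) ⟨
    (x ∸ i) ⊓ suc n                                                        ∎
  ... | no  i≮x = begin
    𝟙[ suc i ≤ x ] + sum (map (λ r → 𝟙[ r ≤ x ]) (range (suc (suc i)) n)) ≡⟨ cong₂ _+_ (𝟙-no i≮x) (sum-𝟙-range x (suc i) n) ⟩
    (x ∸ suc i) ⊓ n                                                        ≡⟨ cong (_⊓ n) (m≤n⇒m∸n≡0 (m≤n⇒m≤1+n x≤i)) ⟩
    0                                                                      ≡⟨ cong (_⊓ suc n) (m≤n⇒m∸n≡0 x≤i) ⟨
    (x ∸ i) ⊓ suc n                                                        ∎
    where
    x≤i : x ≤ i
    x≤i = ≤-pred (≰⇒> i≮x)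

  conj-conjugate : ∀ {la} → Decreasing la → ∀ n t → conj (conjugate n la) (suc t) ≡ la ‼ t ⊓ n
  conj-conjugate {la} d n t = begin
    conj (conjugate n la) (suc t)                               ≡⟨ conj-map (conj la) (range 1 n) (suc t) ⟩
    sum (map (λ r → 𝟙[ suc t ≤ conj la r ]) (range 1 n))      ≡⟨ cong sum (map-cong-local (All-range⁺ 1 n galois)) ⟩
    sum (map (λ r → 𝟙[ r ≤ la ‼ t ]) (range 1 n))             ≡⟨ sum-𝟙-range (la ‼ t) 0 n ⟩
    la ‼ t ⊓ n                                                  ∎
    where
    galois : ∀ {r} → 1 ≤ r → r < 1 + n → 𝟙[ suc t ≤ conj la r ] ≡ 𝟙[ r ≤ la ‼ t ]
    galois {suc r} _ _ = 𝟙-cong (<conj⇒<‼ d t r) (<‼⇒<conj d t r)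

  All-≤-size : ∀ la → All (_≤ size la) la
  All-≤-size []       = []
  All-≤-size (x ∷ xs) = m≤m+n x (size xs) ∷ All.map (λ y≤ → ≤-trans y≤ (m≤n+m _ x)) (All-≤-size xs)

  size-conj : ∀ {B la} → All (_≤ B) la → size la ≡ sum (map (conj la) (range 1 B))
  size-conj {B} [] = sym (sum-map-0 (range 1 B) (λ _ → refl))
  size-conj {B} {x ∷ xs} (x≤B ∷ xs≤B) = sym (begin
    sum (map (conj (x ∷ xs)) (range 1 B))                                      ≡⟨ cong sum (map-cong (conj-∷ x xs) (range 1 B)) ⟩
    sum (map (λ j → 𝟙[ j ≤ x ] + conj xs j) (range 1 B))                       ≡⟨ sum-map-+ (𝟙[_≤ x ]) (conj xs) (range 1 B) ⟩
    sum (map (𝟙[_≤ x ]) (range 1 B)) + sum (map (conj xs) (range 1 B))       ≡⟨ cong₂ _+_ (trans (sum-𝟙-range x 0 B) (m≤n⇒m⊓n≡m x≤B)) (sym (size-conj xs≤B)) ⟩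
    x + size xs                                                                ∎)

  private
    -- The accumulator of nfun is local to Defs; with-abstraction lets unification name it.
    nfun-accumulator : Σ (List ℕ → ℕ → List ℕ → ℕ) λ go → ∀ x xs → nfun (x ∷ xs) ≡ go (x ∷ xs) 1 xs
    nfun-accumulator = go , unfolds
      where
      go : List ℕ → ℕ → List ℕ → ℕ
      go = _
      unfolds : ∀ x xs → nfun (x ∷ xs) ≡ go (x ∷ xs) 1 xs
      unfolds x xs with x ∷ xs | 1
      ... | la | i = refl

    go : List ℕ → ℕ → List ℕ → ℕ
    go = proj₁ nfun-accumulator

    go-suc : ∀ la i xs → go la (suc i) xs ≡ size xs + go la i xs
    go-suc la i []       = refl
    go-suc la i (x ∷ xs) = trans (cong (suc i * x +_) (go-suc la (suc i) xs)) (interchange x (i * x) (size xs) _)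

    go-irrelevant : ∀ la la' i xs → go la i xs ≡ go la' i xs
    go-irrelevant la la' i []       = refl
    go-irrelevant la la' i (x ∷ xs) = cong (i * x +_) (go-irrelevant la la' (suc i) xs)

  nfun-∷ : ∀ x xs → nfun (x ∷ xs) ≡ size xs + nfun xs
  nfun-∷ x []       = refl
  nfun-∷ x (y ∷ ys) = begin
    nfun (x ∷ y ∷ ys)                           ≡⟨ proj₂ nfun-accumulator x (y ∷ ys) ⟩
    go (x ∷ y ∷ ys) 1 (y ∷ ys)                  ≡⟨ go-suc (x ∷ y ∷ ys) 0 (y ∷ ys) ⟩
    size (y ∷ ys) + go (x ∷ y ∷ ys) 1 ys        ≡⟨ cong (size (y ∷ ys) +_) (go-irrelevant (x ∷ y ∷ ys) (y ∷ ys) 1 ys) ⟩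
    size (y ∷ ys) + go (y ∷ ys) 1 ys            ≡⟨ cong (size (y ∷ ys) +_) (proj₂ nfun-accumulator y ys) ⟨
    size (y ∷ ys) + nfun (y ∷ ys)               ∎

  [1+n]C2 : ∀ n → suc n C 2 ≡ n + n C 2
  [1+n]C2 n = trans (sym (nCk+nC[k+1]≡[n+1]C[k+1] n 1)) (cong (_+ n C 2) (nC1≡n n))

  bit+C2 : ∀ t c → t ≤ 1 → (t + c) C 2 ≡ t * c + c C 2
  bit+C2 zero          c _ = refl
  bit+C2 (suc zero)    c _ = trans ([1+n]C2 c) (cong (_+ c C 2) (sym (+-identityʳ c)))
  bit+C2 (suc (suc t)) c (s≤s ())

  nfun-conj : ∀ {B la} → Decreasing la → All (_≤ B) la → nfun la ≡ sum (map (λ j → conj la j C 2) (range 1 B))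
  nfun-conj {B} {[]}     _ []             = sym (sum-map-0 (range 1 B) (λ _ → refl))
  nfun-conj {B} {x ∷ xs} d (x≤B ∷ xs≤B) = begin
    nfun (x ∷ xs)                                                                 ≡⟨ nfun-∷ x xs ⟩
    size xs + nfun xs                                                             ≡⟨ cong₂ _+_ (size-conj xs≤B) (nfun-conj (Decreasing-tail d) xs≤B) ⟩
    sum (map (conj xs) (range 1 B)) + sum (map (λ j → conj xs j C 2) (range 1 B)) ≡⟨ sum-map-+ (conj xs) (λ j → conj xs j C 2) (range 1 B) ⟨
    sum (map (λ j → conj xs j + conj xs j C 2) (range 1 B))                       ≡⟨ cong sum (map-cong add-part (range 1 B)) ⟩
    sum (map (λ j → conj (x ∷ xs) j C 2) (range 1 B))                             ∎
    where
    add-part : ∀ j → conj xs j + conj xs j C 2 ≡ conj (x ∷ xs) j C 2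
    add-part j rewrite conj-∷ x xs j with j ≤? x
    ... | yes j≤x rewrite 𝟙-yes j≤x = sym ([1+n]C2 (conj xs j))
    ... | no  j≰x rewrite 𝟙-no j≰x | conj-vanishes (Decreasing-≤head d) (≰⇒> j≰x) = refl

open Conjugation

module HorizontalStrips where
  open import Data.Nat.Base using (_+_; _∸_)
  open import Data.Nat.Properties
  open import Relation.Binary.PropositionalEquality

  size≤bound : ∀ mu la → size mu + size la ≤ bound mu la
  size≤bound mu la = ≤-trans (m≤m+n _ (length mu)) (≤-trans (m≤m+n _ (length la)) (m≤m+n _ 2))

  bit-ascent : ∀ {c c' a a'} → c' ≤ c → a ≤ 1 → a' ≤ 1 → c + a < c' + a' → a ≡ 0 × a' ≡ 1 × c ∸ c' ≡ 0
  bit-ascent {c} {c'} {zero}     {zero}     c'≤c _ _ c<c' = ⊥-elim (<⇒≱ (subst₂ _<_ (+-identityʳ c) (+-identityʳ c') c<c') c'≤c)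
  bit-ascent {c} {c'} {zero}     {suc zero} c'≤c _ _ c<c'+1 =
    refl , refl , m≤n⇒m∸n≡0 (≤-pred (subst₂ _<_ (+-identityʳ c) (+-comm c' 1) c<c'+1))
  bit-ascent {c} {c'} {suc zero} {zero}     c'≤c _ _ c+1<c' = ⊥-elim (<⇒≱ (<-trans (m<m+n c z<s) (subst (c + 1 <_) (+-identityʳ c') c+1<c')) c'≤c)
  bit-ascent {c} {c'} {suc zero} {suc zero} c'≤c _ _ c+1<c'+1 = ⊥-elim (<⇒≱ (+-cancelʳ-< 1 c c' c+1<c'+1) c'≤c)
  bit-ascent {a = suc (suc _)} _ (s≤s ()) _ _
  bit-ascent {a' = suc (suc _)} _ _ (s≤s ()) _

  StripColumns : List ℕ → List ℕ → Set
  StripColumns mu la = ∀ j → conj mu (suc j) ≤ conj la (suc j) × conj la (suc j) ≤ suc (conj mu (suc j))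

  hstripᵇ⇒StripColumns : ∀ mu la → T (hstripᵇ mu la) → StripColumns mu la
  hstripᵇ⇒StripColumns mu la strip j with suc j ≤? bound mu la
  ... | yes j<bound = ≤ᵇ⇒≤ _ _ lower , ≤ᵇ⇒≤ _ _ upper
    where
    columns = proj₂ (Equivalence.to (T-∧ {containedᵇ mu la}) strip)
    bounds = allB-range1⁻ (λ i → (conj mu i ≤ᵇ conj la i) ∧ (conj la i ≤ᵇ suc (conj mu i))) (bound mu la) columns j<bound
    lower = proj₁ (Equivalence.to (T-∧ {conj mu (suc j) ≤ᵇ conj la (suc j)}) bounds)
    upper = proj₂ (Equivalence.to (T-∧ {conj mu (suc j) ≤ᵇ conj la (suc j)}) bounds)
  ... | no j≮bound = subst₂ (λ a b → a ≤ b × b ≤ suc a)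
                            (sym (conj-vanishes (All-≤-size mu) (beyond (m≤m+n (size mu) (size la)))))
                            (sym (conj-vanishes (All-≤-size la) (beyond (m≤n+m (size la) (size mu)))))
                            (z≤n , z≤n)
    where
    beyond : ∀ {n} → n ≤ size mu + size la → n < suc j
    beyond n≤ = ≤-<-trans n≤ (≤-<-trans (size≤bound mu la) (≰⇒> j≮bound))

  StripColumns⇒hstripᵇ : ∀ {mu la} → Decreasing mu → Decreasing la → StripColumns mu la → T (hstripᵇ mu la)
  StripColumns⇒hstripᵇ {mu} {la} dμ dλ strip = Equivalence.from (T-∧ {containedᵇ mu la}) (contained , columns)
    where
    contained = allB-range1⁺ (λ i → part mu i ≤ᵇ part la i) (bound mu la) λ {t} _ →
      ≤⇒≤ᵇ (conj-≤⇒‼-≤ dμ dλ (proj₁ ∘ strip) t)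
    columns = allB-range1⁺ (λ i → (conj mu i ≤ᵇ conj la i) ∧ (conj la i ≤ᵇ suc (conj mu i))) (bound mu la) λ {t} _ →
      Equivalence.from (T-∧ {conj mu (suc t) ≤ᵇ conj la (suc t)}) (≤⇒≤ᵇ (proj₁ (strip t)) , ≤⇒≤ᵇ (proj₂ (strip t)))

open HorizontalStrips

module Bijection {mu : List ℕ} (dμ : Decreasing mu) {k' : ℕ} (ω : Vec Bool (suc k')) (N : ℕ) where
  open import Data.Nat.Base using (_+_; _*_; _∸_; _⊓_)
  open import Data.Nat.Combinatorics using (_C_)
  open import Data.Nat.Properties
  open import Data.List.Relation.Unary.All.Properties using (map⁺)
  import Data.Vec.Base as Vec
  open import Data.Vec.Properties using (length-toList)
  open import Relation.Binary.PropositionalEquality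
  open ≡-Reasoning

  k M K : ℕ
  k = suc k'
  M = size mu + N
  K = k + M

  ω̂ : List ℕ
  ω̂ = Vec.toList (Vec.map b2n ω)

  length-ω̂ : length ω̂ ≡ k
  length-ω̂ = length-toList (Vec.map b2n ω)

  ω̂-bits : All (_≤ 1) ω̂
  ω̂-bits = bits ω
    where
    bits : ∀ {n} (v : Vec Bool n) → All (_≤ 1) (Vec.toList (Vec.map b2n v))
    bits Vec.[]            = []
    bits (true  Vec.∷ v) = s≤s z≤n ∷ bits v
    bits (false Vec.∷ v) = z≤n ∷ bits v

  -- K columns suffice: beyond column M both μ' and λ' vanish.
  columns : List ℕ → List ℕ
  columns la = map (θ' mu la) (range 1 K)

  profile : List ℕ → List ℕ
  profile b = map (λ j → conj mu j + part b j) (range 1 K)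

  shape : List ℕ → List ℕ
  shape b = conjugate M (profile b)

  Valid : List ℕ → Bool
  Valid la = decreasingᵇ la ∧ (size la ≡ᵇ M) ∧ hstripᵇ mu la ∧ matchesᵇ k ω mu la

  Admissible : List ℕ → Bool
  Admissible b = (ω̂ ≼ᵇ b) ∧ (sum b ≡ᵇ N) ∧ decreasingᵇ (profile b)

  M≤K : M ≤ K
  M≤K = m≤n+m M k

  mu≤K : All (_≤ K) mu
  mu≤K = All.map (λ x≤ → ≤-trans x≤ (≤-trans (m≤m+n (size mu) N) M≤K)) (All-≤-size mu)

  mu-vanishes : ∀ {j} → M < j → conj mu j ≡ 0
  mu-vanishes M<j = conj-vanishes (All-≤-size mu) (≤-<-trans (m≤m+n (size mu) N) M<j)

  Admissible⁻ : ∀ b → T (Admissible b) → T (ω̂ ≼ᵇ b) × sum b ≡ N × Decreasing (profile b)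
  Admissible⁻ b adm = let ω̂≼b , rest = Equivalence.to (T-∧ {ω̂ ≼ᵇ b}) adm
                          sum≡N , dec = Equivalence.to (T-∧ {sum b ≡ᵇ N}) rest
                      in ω̂≼b , ≡ᵇ⇒≡ _ _ sum≡N , decreasingᵇ-sound (profile b) dec

  module Shape {b} (b∈ : InLists K 1 b) (sum≡N : sum b ≡ N) (dec : Decreasing (profile b)) where

    conj-shape : ∀ t → conj (shape b) (suc t) ≡ conj mu (suc t) + b ‼ t
    conj-shape t with t <? K
    ... | yes t<K = begin
      conj (shape b) (suc t)              ≡⟨ conj-conjugate dec M t ⟩
      profile b ‼ t ⊓ M                   ≡⟨ cong (_⊓ M) (‼-map-range _ 1 K t<K) ⟩
      (conj mu (suc t) + b ‼ t) ⊓ M       ≡⟨ m≤n⇒m⊓n≡m (+-mono-≤ (conj-suc≤size mu t) (subst (b ‼ t ≤_) sum≡N (‼-bounded (All-≤-size b) t))) ⟩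
      conj mu (suc t) + b ‼ t             ∎
    ... | no t≮K = begin
      conj (shape b) (suc t)              ≡⟨ conj-conjugate dec M t ⟩
      profile b ‼ t ⊓ M                   ≡⟨ cong (_⊓ M) (‼-beyond (profile b) (≤-trans (≤-reflexive (length-map-range _ 1 K)) (≮⇒≥ t≮K))) ⟩
      0                                   ≡⟨ cong₂ _+_ (mu-vanishes (s≤s (≤-trans M≤K (≮⇒≥ t≮K)))) (‼-beyond b (≤-trans (≤-reflexive (proj₁ b∈)) (≮⇒≥ t≮K))) ⟨
      conj mu (suc t) + b ‼ t             ∎

    θ'-shape : ∀ t → θ' mu (shape b) (suc t) ≡ b ‼ t
    θ'-shape t = trans (cong (_∸ conj mu (suc t)) (conj-shape t)) (m+n∸m≡n (conj mu (suc t)) (b ‼ t))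

    columns-shape : columns (shape b) ≡ b
    columns-shape = trans (map-cong-range1 K θ'-shape) (map-part-range b (proj₁ b∈))

    size-shape : size (shape b) ≡ M
    size-shape = begin
      size (shape b)                                                     ≡⟨ size-conj (subst (λ n → All (_≤ n) (shape b)) (length-map-range _ 1 K) (conjugate-bounded M (profile b))) ⟩
      sum (map (conj (shape b)) (range 1 K))                             ≡⟨ cong sum (map-cong-range1 K conj-shape) ⟩
      sum (map (λ j → conj mu j + part b j) (range 1 K))                 ≡⟨ sum-map-+ (conj mu) (part b) (range 1 K) ⟩
      sum (map (conj mu) (range 1 K)) + sum (map (part b) (range 1 K))   ≡⟨ cong₂ _+_ (sym (size-conj mu≤K)) (trans (cong sum (map-part-range b (proj₁ b∈))) sum≡N) ⟩
      M                                                                  ∎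

    shape∈ : InLists M M (shape b)
    shape∈ = length-conjugate M (profile b) , All.map (λ x≤ → ≤-trans x≤ (≤-reflexive size-shape)) (All-≤-size (shape b))

    shape-valid : T (ω̂ ≼ᵇ b) → T (Valid (shape b))
    shape-valid ω̂≼b = Equivalence.from (T-∧ {decreasingᵇ (shape b)})
      (decreasingᵇ-complete (conjugate-decreasing M (profile b)) , Equivalence.from (T-∧ {size (shape b) ≡ᵇ M})
      (≡⇒≡ᵇ _ _ size-shape , Equivalence.from (T-∧ {hstripᵇ mu (shape b)})
      (StripColumns⇒hstripᵇ dμ (conjugate-decreasing M (profile b)) strip , matches)))
      where
      strip : StripColumns mu (shape b)
      strip t rewrite conj-shape t = m≤m+n _ _ , ≤-trans (+-monoʳ-≤ _ (‼-bounded (proj₂ b∈) t)) (≤-reflexive (+-comm _ 1))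
      matches : T (matchesᵇ k ω mu (shape b))
      matches = allB-range1⁺ (λ i → θ' mu (shape b) i ≡ᵇ ωat ω i) k λ {t} t<k →
        ≡⇒≡ᵇ _ _ (trans (θ'-shape t) (≼ᵇ-‼ ω̂ b ω̂≼b (subst (t <_) (sym length-ω̂) t<k)))

  module Columns {la} (la∈ : InLists M M la) (valid : T (Valid la)) where
    private
      parts = Equivalence.to (T-∧ {decreasingᵇ la}) valid
      rest₁ = Equivalence.to (T-∧ {size la ≡ᵇ M}) (proj₂ parts)
      rest₂ = Equivalence.to (T-∧ {hstripᵇ mu la}) (proj₂ rest₁)

    dλ : Decreasing la
    dλ = decreasingᵇ-sound la (proj₁ parts)

    size≡M : size la ≡ M
    size≡M = ≡ᵇ⇒≡ _ _ (proj₁ rest₁)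

    strip : StripColumns mu la
    strip = hstripᵇ⇒StripColumns mu la (proj₁ rest₂)

    la≤K : All (_≤ K) la
    la≤K = All.map (λ x≤ → ≤-trans x≤ M≤K) (proj₂ la∈)

    la-vanishes : ∀ {j} → M < j → conj la j ≡ 0
    la-vanishes = conj-vanishes (proj₂ la∈)

    conj-split : ∀ t → conj la (suc t) ≡ conj mu (suc t) + θ' mu la (suc t)
    conj-split t = sym (m+[n∸m]≡n (proj₁ (strip t)))

    θ'≤1 : ∀ t → θ' mu la (suc t) ≤ 1
    θ'≤1 t = ≤-trans (∸-monoˡ-≤ (conj mu (suc t)) (proj₂ (strip t))) (≤-reflexive (m+n∸n≡m 1 (conj mu (suc t))))

    conj-columns : ∀ t → conj mu (suc t) + columns la ‼ t ≡ conj la (suc t)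
    conj-columns t with t <? K
    ... | yes t<K = trans (cong (conj mu (suc t) +_) (‼-map-range _ 1 K t<K)) (sym (conj-split t))
    ... | no  t≮K = begin
      conj mu (suc t) + columns la ‼ t   ≡⟨ cong₂ _+_ (mu-vanishes M<1+t) (‼-beyond (columns la) (≤-trans (≤-reflexive (length-map-range _ 1 K)) (≮⇒≥ t≮K))) ⟩
      0                                  ≡⟨ la-vanishes M<1+t ⟨
      conj la (suc t)                    ∎
      where
      M<1+t : M < suc t
      M<1+t = s≤s (≤-trans M≤K (≮⇒≥ t≮K))

    columns∈ : InLists K 1 (columns la)
    columns∈ = length-map-range _ 1 K ,
               map⁺ (All-range1⁺ K θ'≤1)

    sum-columns : sum (columns la) ≡ N
    sum-columns = +-cancelˡ-≡ (size mu) _ _ (begin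
      size mu + sum (columns la)                                            ≡⟨ cong (_+ sum (columns la)) (size-conj mu≤K) ⟩
      sum (map (conj mu) (range 1 K)) + sum (map (θ' mu la) (range 1 K))    ≡⟨ sum-map-+ (conj mu) (θ' mu la) (range 1 K) ⟨
      sum (map (λ j → conj mu j + θ' mu la j) (range 1 K))                  ≡⟨ cong sum (map-cong-range1 K (sym ∘ conj-split)) ⟩
      sum (map (conj la) (range 1 K))                                       ≡⟨ size-conj la≤K ⟨
      size la                                                               ≡⟨ size≡M ⟩
      size mu + N                                                           ∎)

    profile-columns : profile (columns la) ≡ map (conj la) (range 1 K)
    profile-columns = map-cong-range1 K conj-columns

    profile-decreasing : Decreasing (profile (columns la))
    profile-decreasing = subst Decreasing (sym profile-columns) (map-range-decreasing (λ j → conj-antitone la (n≤1+n j)) 1 K)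

    columns-admissible : T (Admissible (columns la))
    columns-admissible = Equivalence.from (T-∧ {ω̂ ≼ᵇ columns la})
      (‼-≼ᵇ ω̂ (columns la) (≤-trans (≤-reflexive length-ω̂) (subst (k ≤_) (sym (proj₁ columns∈)) (m≤m+n k M))) prefix ,
       Equivalence.from (T-∧ {sum (columns la) ≡ᵇ N}) (≡⇒≡ᵇ _ _ sum-columns , decreasingᵇ-complete profile-decreasing))
      where
      prefix : ∀ {t} → t < length ω̂ → columns la ‼ t ≡ ω̂ ‼ t
      prefix {t} t<k = trans (‼-map-range _ 1 K (<-≤-trans t<k (≤-trans (≤-reflexive length-ω̂) (m≤m+n k M))))
        (≡ᵇ⇒≡ _ _ (allB-range1⁻ (λ i → θ' mu la i ≡ᵇ ωat ω i) k (proj₂ rest₂) (subst (t <_) length-ω̂ t<k)))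

    shape-columns : shape (columns la) ≡ la
    shape-columns = conj-injective (conjugate-decreasing M (profile (columns la))) dλ
      (trans (length-conjugate M (profile (columns la))) (sym (proj₁ la∈)))
      (λ t → trans (Shape.conj-shape columns∈ sum-columns profile-decreasing t) (conj-columns t))

    nfun-columns : nfun la ≡ nfun mu + sum (map (λ j → θ' mu la j * conj mu j) (range 1 K))
    nfun-columns = begin
      nfun la                                                                ≡⟨ nfun-conj dλ la≤K ⟩
      sum (map (λ j → conj la j C 2) (range 1 K))                            ≡⟨ cong sum (map-cong-range1 K split) ⟩
      sum (map (λ j → θ' mu la j * conj mu j + conj mu j C 2) (range 1 K))   ≡⟨ sum-map-+ (λ j → θ' mu la j * conj mu j) (λ j → conj mu j C 2) (range 1 K) ⟩
      E + sum (map (λ j → conj mu j C 2) (range 1 K))                        ≡⟨ cong (E +_) (nfun-conj dμ mu≤K) ⟨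
      E + nfun mu                                                            ≡⟨ +-comm E (nfun mu) ⟩
      nfun mu + E                                                            ∎
      where
      E = sum (map (λ j → θ' mu la j * conj mu j) (range 1 K))
      split : ∀ t → conj la (suc t) C 2 ≡ θ' mu la (suc t) * conj mu (suc t) + conj mu (suc t) C 2
      split t = trans (cong (_C 2) (trans (conj-split t) (+-comm (conj mu (suc t)) _))) (bit+C2 (θ' mu la (suc t)) (conj mu (suc t)) (θ'≤1 t))

    θ'-vanishes : ∀ {j} → M ≤ j → θ' mu la (suc j) ≡ 0
    θ'-vanishes {j} M≤j = trans (cong (_∸ conj mu (suc j)) (la-vanishes (s≤s M≤j))) (0∸n≡0 (conj mu (suc j)))

  columns-inverse : ∀ {la} → InLists M M la → T (Valid la) →
                    InLists K 1 (columns la) × T (Admissible (columns la)) × shape (columns la) ≡ la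
  columns-inverse la∈ valid = columns∈ , columns-admissible , shape-columns
    where
    open Columns la∈ valid

  shape-inverse : ∀ {b} → InLists K 1 b → T (Admissible b) → InLists M M (shape b) × T (Valid (shape b)) × columns (shape b) ≡ b
  shape-inverse {b} b∈ adm = shape∈ , shape-valid (proj₁ parts) , columns-shape
    where
    parts = Admissible⁻ b adm
    open Shape b∈ (proj₁ (proj₂ parts)) (proj₂ (proj₂ parts))

module Sums {c ℓ} (R : CommutativeRing c ℓ) where
  open import Data.Bool.Properties using (T?)
  open import Relation.Binary.Definitions using (DecidableEquality)
  open import Level using (_⊔_)
  import Data.Nat.Base as ℕ
  import Data.Nat.Properties as ℕ
  open CommutativeRing R hiding (zero)
  open RingDefs R
  open import Algebra.Properties.CommutativeSemigroup +-commutativeSemigroup using () renaming (interchange to +-interchange)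
  open import Relation.Binary.Reasoning.Setoid setoid

  ∑ : ∀ {A : Set} → (A → Carrier) → List A → Carrier
  ∑ f xs = sumR (map f xs)

  ∏ : ∀ {A : Set} → (A → Carrier) → List A → Carrier
  ∏ f xs = prodR (map f xs)

  [_]·_ : Bool → Carrier → Carrier
  [ b ]· x = if b then x else 0#

  []·-true : ∀ {b} x → T b → [ b ]· x ≡ x
  []·-true {true} x _ = ≡.refl

  []·-false : ∀ {b} x → ¬ T b → [ b ]· x ≡ 0#
  []·-false {true}  x ¬b = ⊥-elim (¬b tt)
  []·-false {false} x ¬b = ≡.refl

  []·-0# : ∀ b → [ b ]· 0# ≡ 0#
  []·-0# true  = ≡.refl
  []·-0# false = ≡.refl

  []·-∧ : ∀ a b x → [ a ∧ b ]· x ≡ [ a ]· [ b ]· x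
  []·-∧ true  b x = ≡.refl
  []·-∧ false b x = ≡.refl

  []·-cong : ∀ b {x y} → (T b → x ≈ y) → [ b ]· x ≈ [ b ]· y
  []·-cong true  x≈y = x≈y tt
  []·-cong false _   = refl

  []·-*ˡ : ∀ b a x → [ b ]· (a * x) ≈ a * [ b ]· x
  []·-*ˡ true  a x = refl
  []·-*ˡ false a x = sym (zeroʳ a)

  []·-redundant : ∀ b {x} → (¬ T b → x ≈ 0#) → [ b ]· x ≈ x
  []·-redundant true  _   = refl
  []·-redundant false x≈0 = sym (x≈0 (λ ()))

  ∑-cong : ∀ {A : Set} {f g : A → Carrier} → (∀ x → f x ≈ g x) → ∀ xs → ∑ f xs ≈ ∑ g xs
  ∑-cong f≈g []       = refl
  ∑-cong f≈g (x ∷ xs) = +-cong (f≈g x) (∑-cong f≈g xs)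

  ∑-cong-local : ∀ {A : Set} {f g : A → Carrier} {xs} → All (λ x → f x ≈ g x) xs → ∑ f xs ≈ ∑ g xs
  ∑-cong-local []           = refl
  ∑-cong-local (fx≈gx ∷ hs) = +-cong fx≈gx (∑-cong-local hs)

  ∑-zero-local : ∀ {A : Set} {f : A → Carrier} {xs} → All (λ x → f x ≈ 0#) xs → ∑ f xs ≈ 0#
  ∑-zero-local []          = refl
  ∑-zero-local (fx≈0 ∷ hs) = trans (+-cong fx≈0 (∑-zero-local hs)) (+-identityˡ 0#)

  ∑-zero : ∀ {A : Set} {f : A → Carrier} → (∀ x → f x ≈ 0#) → ∀ xs → ∑ f xs ≈ 0#
  ∑-zero f≈0 xs = ∑-zero-local (All.universal f≈0 xs)

  ∏-one-local : ∀ {A : Set} {f : A → Carrier} {xs} → All (λ x → f x ≈ 1#) xs → ∏ f xs ≈ 1#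
  ∏-one-local []          = refl
  ∏-one-local (fx≈1 ∷ hs) = trans (*-cong fx≈1 (∏-one-local hs)) (*-identityˡ 1#)

  ∏-zero : ∀ {A : Set} {f : A → Carrier} {xs} → Any (λ x → f x ≈ 0#) xs → ∏ f xs ≈ 0#
  ∏-zero (here fx≈0) = trans (*-congʳ fx≈0) (zeroˡ _)
  ∏-zero (there any) = trans (*-congˡ (∏-zero any)) (zeroʳ _)

  ∑-+ : ∀ {A : Set} (f g : A → Carrier) xs → ∑ (λ x → f x + g x) xs ≈ ∑ f xs + ∑ g xs
  ∑-+ f g []       = sym (+-identityˡ 0#)
  ∑-+ f g (x ∷ xs) = trans (+-congˡ (∑-+ f g xs)) (+-interchange (f x) (g x) (∑ f xs) (∑ g xs))

  ∑-*ˡ : ∀ {A : Set} a (f : A → Carrier) xs → ∑ (λ x → a * f x) xs ≈ a * ∑ f xs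
  ∑-*ˡ a f []       = sym (zeroʳ a)
  ∑-*ˡ a f (x ∷ xs) = trans (+-congˡ (∑-*ˡ a f xs)) (sym (distribˡ a (f x) (∑ f xs)))

  ∑-[]· : ∀ {A : Set} b (f : A → Carrier) xs → ∑ (λ x → [ b ]· f x) xs ≈ [ b ]· ∑ f xs
  ∑-[]· true  f xs = refl
  ∑-[]· false f xs = ∑-zero (λ _ → refl) xs

  ∑-++ : ∀ {A : Set} (f : A → Carrier) xs ys → ∑ f (xs ++ ys) ≈ ∑ f xs + ∑ f ys
  ∑-++ f []       ys = sym (+-identityˡ _)
  ∑-++ f (x ∷ xs) ys = trans (+-congˡ (∑-++ f xs ys)) (sym (+-assoc _ _ _))

  ∏-++ : ∀ {A : Set} (f : A → Carrier) xs ys → ∏ f (xs ++ ys) ≈ ∏ f xs * ∏ f ys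
  ∏-++ f []       ys = sym (*-identityˡ _)
  ∏-++ f (x ∷ xs) ys = trans (*-congˡ (∏-++ f xs ys)) (sym (*-assoc _ _ _))

  ∑-map : ∀ {A B : Set} (f : B → Carrier) (g : A → B) xs → ∑ f (map g xs) ≡ ∑ (f ∘ g) xs
  ∑-map f g []       = ≡.refl
  ∑-map f g (x ∷ xs) = ≡.cong (f (g x) +_) (∑-map f g xs)

  ∑-concatMap : ∀ {A B : Set} (f : B → Carrier) (h : A → List B) xs → ∑ f (concatMap h xs) ≈ ∑ (λ x → ∑ f (h x)) xs
  ∑-concatMap f h []       = refl
  ∑-concatMap f h (x ∷ xs) = trans (∑-++ f (h x) (concatMap h xs)) (+-congˡ (∑-concatMap f h xs))

  ∑-swap : ∀ {A B : Set} (F : A → B → Carrier) xs ys → ∑ (λ x → ∑ (F x) ys) xs ≈ ∑ (λ y → ∑ (λ x → F x y) xs) ys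
  ∑-swap F []       ys = sym (∑-zero (λ _ → refl) ys)
  ∑-swap F (x ∷ xs) ys = trans (+-congˡ (∑-swap F xs ys)) (sym (∑-+ (F x) (λ y → ∑ (λ x → F x y) xs) ys))

  ∑-lists-suc : ∀ (F : List ℕ → Carrier) L M → ∑ F (lists (suc L) M) ≈ ∑ (λ x → ∑ (λ t → F (x ∷ t)) (lists L M)) (upTo (suc M))
  ∑-lists-suc F L M = trans (∑-concatMap F (λ x → map (x ∷_) (lists L M)) (upTo (suc M)))
                            (∑-cong (λ x → reflexive (∑-map F (x ∷_) (lists L M))) (upTo (suc M)))

  ∑-range-δ : ∀ (G : ℕ → Carrier) {y} i n → i ≤ y → y < i ℕ.+ n → ∑ (λ x → [ y ≡ᵇ x ]· G x) (range i n) ≈ G y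
  ∑-range-δ G i zero    i≤y y<i+0 = ⊥-elim (ℕ.<⇒≱ y<i+0 (≡.subst (_≤ _) (≡.sym (ℕ.+-identityʳ i)) i≤y))
  ∑-range-δ G {y} i (suc n) i≤y y<i+n with y ℕ.≟ i
  ... | yes ≡.refl = begin
    [ y ≡ᵇ y ]· G y + ∑ (λ x → [ y ≡ᵇ x ]· G x) (range (suc y) n) ≈⟨ +-cong (reflexive ([]·-true (G y) (ℕ.≡⇒≡ᵇ y y ≡.refl)))
                                                                               (∑-zero-local (All-range⁺ (suc y) n later)) ⟩
    G y + 0#                                                       ≈⟨ +-identityʳ (G y) ⟩
    G y                                                            ∎
    where
    later : ∀ {x} → y < x → x < suc y ℕ.+ n → [ y ≡ᵇ x ]· G x ≈ 0#
    later y<x _ = reflexive ([]·-false (G _) (ℕ.<⇒≢ y<x ∘ ℕ.≡ᵇ⇒≡ y _))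
  ... | no y≢i = begin
    [ y ≡ᵇ i ]· G i + ∑ (λ x → [ y ≡ᵇ x ]· G x) (range (suc i) n) ≈⟨ +-cong (reflexive ([]·-false (G i) (y≢i ∘ ℕ.≡ᵇ⇒≡ y i)))
                                                                               (∑-range-δ G (suc i) n (ℕ.≤∧≢⇒< i≤y (y≢i ∘ ≡.sym))
                                                                                  (≡.subst (y <_) (ℕ.+-suc i n) y<i+n)) ⟩
    0# + G y                                                       ≈⟨ +-identityˡ (G y) ⟩
    G y                                                            ∎

  ∑-upTo-δ : ∀ (G : ℕ → Carrier) {y n} → y < n → ∑ (λ x → [ y ≡ᵇ x ]· G x) (upTo n) ≈ G y
  ∑-upTo-δ G {y} {n} y<n = ≡.subst (λ xs → ∑ (λ x → [ y ≡ᵇ x ]· G x) xs ≈ G y) (≡.sym (upTo≡range n))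
                                   (∑-range-δ G 0 n z≤n y<n)

  ∑-lists-prefix : ∀ {L M} u → All (_≤ M) u → (F : List ℕ → Carrier) →
                   ∑ (λ b → [ u ≼ᵇ b ]· F b) (lists (length u ℕ.+ L) M) ≈ ∑ (λ t → F (u ++ t)) (lists L M)
  ∑-lists-prefix         []      []           F = refl
  ∑-lists-prefix {L} {M} (y ∷ u) (y≤M ∷ u≤M) F = begin
    ∑ (λ b → [ (y ∷ u) ≼ᵇ b ]· F b) (lists (suc (length u ℕ.+ L)) M)
      ≈⟨ ∑-lists-suc _ (length u ℕ.+ L) M ⟩
    ∑ (λ x → ∑ (λ t → [ (y ≡ᵇ x) ∧ (u ≼ᵇ t) ]· F (x ∷ t)) tails) (upTo (suc M))
      ≈⟨ ∑-cong (λ x → trans (∑-cong (λ t → reflexive ([]·-∧ (y ≡ᵇ x) (u ≼ᵇ t) (F (x ∷ t)))) tails)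
                               (∑-[]· (y ≡ᵇ x) (λ t → [ u ≼ᵇ t ]· F (x ∷ t)) tails)) (upTo (suc M)) ⟩
    ∑ (λ x → [ y ≡ᵇ x ]· ∑ (λ t → [ u ≼ᵇ t ]· F (x ∷ t)) tails) (upTo (suc M))
      ≈⟨ ∑-upTo-δ (λ x → ∑ (λ t → [ u ≼ᵇ t ]· F (x ∷ t)) tails) (s≤s y≤M) ⟩
    ∑ (λ t → [ u ≼ᵇ t ]· F (y ∷ t)) tails
      ≈⟨ ∑-lists-prefix u u≤M (F ∘ (y ∷_)) ⟩
    ∑ (λ t → F (y ∷ u ++ t)) (lists L M)
      ∎
    where
    tails = lists (length u ℕ.+ L) M

  CountsOnce : ∀ {A : Set} → DecidableEquality A → List A → A → Set (c ⊔ ℓ)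
  CountsOnce _≟_ xs a = ∀ v → ∑ (λ x → [ does (a ≟ x) ]· v) xs ≈ v

  lists-counts-once : ∀ {L M t₀} → InLists L M t₀ → CountsOnce (≡-dec ℕ._≟_) (lists L M) t₀
  lists-counts-once {L} {M} {t₀} (≡.refl , t₀≤M) v = begin
    ∑ (λ t → [ does (≡-dec ℕ._≟_ t₀ t) ]· v) (lists (length t₀) M)
      ≈⟨ ∑-cong-local (All.map (λ (len , _) → reflexive (≡.cong ([_]· v) (≟-≼ᵇ t₀ _ (≡.sym len)))) (All-lists (length t₀) M)) ⟩
    ∑ (λ t → [ t₀ ≼ᵇ t ]· v) (lists (length t₀) M)
      ≡⟨ ≡.cong (λ n → ∑ (λ t → [ t₀ ≼ᵇ t ]· v) (lists n M)) (ℕ.+-identityʳ (length t₀)) ⟨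
    ∑ (λ t → [ t₀ ≼ᵇ t ]· v) (lists (length t₀ ℕ.+ 0) M)
      ≈⟨ ∑-lists-prefix t₀ t₀≤M (λ _ → v) ⟩
    v + 0#
      ≈⟨ +-identityʳ v ⟩
    v ∎

  ∑-reindex : ∀ {A B : Set} (_≟ᴬ_ : DecidableEquality A) (_≟ᴮ_ : DecidableEquality B) {xs ys}
              {P : A → Bool} {Q : B → Bool} (f : A → B) (g : B → A) (u : A → Carrier) →
              All (λ a → T (P a) → CountsOnce _≟ᴮ_ ys (f a) × T (Q (f a)) × g (f a) ≡ a) xs →
              All (λ b → T (Q b) → CountsOnce _≟ᴬ_ xs (g b) × T (P (g b)) × f (g b) ≡ b) ys →
              ∑ (λ a → [ P a ]· u a) xs ≈ ∑ (λ b → [ Q b ]· u (g b)) ys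
  ∑-reindex {A} {B} _≟ᴬ_ _≟ᴮ_ {xs} {ys} {P} {Q} f g u forward backward = begin
    ∑ (λ a → [ P a ]· u a) xs                      ≈⟨ ∑-cong-local (All.map spread forward) ⟨
    ∑ (λ a → ∑ (λ b → term a b) ys) xs             ≈⟨ ∑-swap term xs ys ⟩
    ∑ (λ b → ∑ (λ a → term a b) xs) ys             ≈⟨ ∑-cong-local (All.map fibre backward) ⟩
    ∑ (λ b → [ Q b ]· u (g b)) ys                  ∎
    where
    term : A → B → Carrier
    term a b = [ does (f a ≟ᴮ b) ]· [ P a ]· u a

    Forward : A → Set (c ⊔ ℓ)
    Forward a = T (P a) → CountsOnce _≟ᴮ_ ys (f a) × T (Q (f a)) × g (f a) ≡ a

    spread : ∀ {a} → Forward a → ∑ (term a) ys ≈ [ P a ]· u a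
    spread {a} fw with T? (P a)
    ... | yes Pa = proj₁ (fw Pa) ([ P a ]· u a)
    ... | no ¬Pa = trans (∑-zero (λ b → reflexive (≡.trans (≡.cong ([ does (f a ≟ᴮ b) ]·_) ([]·-false (u a) ¬Pa)) ([]·-0# (does (f a ≟ᴮ b))))) ys)
                         (reflexive (≡.sym ([]·-false (u a) ¬Pa)))

    only : ∀ {b} → T (P (g b)) → f (g b) ≡ b → ∀ {a} → Forward a → term a b ≈ [ does (g b ≟ᴬ a) ]· u (g b)
    only {b} P[gb] f[gb]≡b {a} fw with f a ≟ᴮ b | g b ≟ᴬ a
    ... | yes _       | yes ≡.refl = reflexive ([]·-true (u (g b)) P[gb])
    ... | no  fa≢b    | yes ≡.refl = ⊥-elim (fa≢b f[gb]≡b)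
    ... | no  _       | no  _      = refl
    ... | yes ≡.refl  | no  gfa≢a with T? (P a)
    ...   | yes Pa = ⊥-elim (gfa≢a (proj₂ (proj₂ (fw Pa))))
    ...   | no ¬Pa = reflexive ([]·-false (u a) ¬Pa)

    none : ∀ {b} → ¬ T (Q b) → ∀ {a} → Forward a → term a b ≈ 0#
    none {b} ¬Qb {a} fw with f a ≟ᴮ b
    ... | no  _      = refl
    ... | yes ≡.refl with T? (P a)
    ...   | yes Pa = ⊥-elim (¬Qb (proj₁ (proj₂ (fw Pa))))
    ...   | no ¬Pa = reflexive ([]·-false (u a) ¬Pa)

    fibre : ∀ {b} → (T (Q b) → CountsOnce _≟ᴬ_ xs (g b) × T (P (g b)) × f (g b) ≡ b) → ∑ (λ a → term a b) xs ≈ [ Q b ]· u (g b)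
    fibre {b} bw with T? (Q b)
    ... | yes Qb = let once , P[gb] , f[gb]≡b = bw Qb in begin
      ∑ (λ a → term a b) xs                        ≈⟨ ∑-cong-local (All.map (only P[gb] f[gb]≡b) forward) ⟩
      ∑ (λ a → [ does (g b ≟ᴬ a) ]· u (g b)) xs    ≈⟨ once (u (g b)) ⟩
      u (g b)                                      ≡⟨ []·-true (u (g b)) Qb ⟨
      [ Q b ]· u (g b)                             ∎
    ... | no ¬Qb = trans (∑-zero-local (All.map (none ¬Qb) forward)) (reflexive (≡.sym ([]·-false (u (g b)) ¬Qb)))

  ∏-truncate : ∀ {f : ℕ → Carrier} m n → m ≤ n → (∀ {j} → m ≤ j → f j ≈ 1#) → ∏ f (range 1 n) ≈ ∏ f (range 1 m)
  ∏-truncate {f} m n m≤n f≈1 = begin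
    ∏ f (range 1 n)                                           ≡⟨ ≡.cong (λ l → ∏ f (range 1 l)) (ℕ.m+[n∸m]≡n m≤n) ⟨
    ∏ f (range 1 (m ℕ.+ (n ℕ.∸ m)))                           ≡⟨ ≡.cong (∏ f) (range-++ 1 m (n ℕ.∸ m)) ⟩
    ∏ f (range 1 m ++ range (suc m) (n ℕ.∸ m))                ≈⟨ ∏-++ f (range 1 m) (range (suc m) (n ℕ.∸ m)) ⟩
    ∏ f (range 1 m) * ∏ f (range (suc m) (n ℕ.∸ m))           ≈⟨ *-congˡ (∏-one-local (All-range⁺ (suc m) (n ℕ.∸ m) (λ m<j _ → f≈1 (ℕ.<⇒≤ m<j)))) ⟩
    ∏ f (range 1 m) * 1#                                      ≈⟨ *-identityʳ _ ⟩
    ∏ f (range 1 m)                                           ∎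

  pow-+ : ∀ x m n → pow x (m ℕ.+ n) ≈ pow x m * pow x n
  pow-+ x zero    n = sym (*-identityˡ _)
  pow-+ x (suc m) n = trans (*-congˡ (pow-+ x m n)) (sym (*-assoc _ _ _))


module PowerSeries {c ℓ} (R : CommutativeRing c ℓ) where
  import Data.Nat.Base as ℕ
  import Data.Nat.Properties as ℕ
  open import Data.List.Properties using (upTo-∷ʳ)
  open import Data.List.Relation.Unary.All.Properties using (all-upTo)
  open CommutativeRing R hiding (zero)
  open RingDefs R
  open Sums R
  open import Algebra.Properties.Ring ring using (-‿distribˡ-*; x[y-z]≈xy-xz)
  open import Algebra.Properties.Group +-group using (ε⁻¹≈ε)
  open import Relation.Nullary using (Dec)
  open import Relation.Binary.Reasoning.Setoid setoid

  shift : ℕ → Series → Series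
  shift zero    f n       = f n
  shift (suc s) f zero    = 0#
  shift (suc s) f (suc n) = shift s f n

  shift-≤ : ∀ s f {n} → s ≤ n → shift s f n ≡ f (n ℕ.∸ s)
  shift-≤ zero    f s≤n       = ≡.refl
  shift-≤ (suc s) f (s≤s s≤n) = shift-≤ s f s≤n

  shift-< : ∀ s f {n} → n < s → shift s f n ≡ 0#
  shift-< (suc s) f {zero}  _         = ≡.refl
  shift-< (suc s) f {suc n} (s≤s n<s) = shift-< s f n<s

  shift-cong-≤ : ∀ s {f g n} → (∀ {m} → m ≤ n → f m ≈ g m) → shift s f n ≈ shift s g n
  shift-cong-≤ zero            f≈g = f≈g ℕ.≤-refl
  shift-cong-≤ (suc s) {n = zero}  f≈g = refl
  shift-cong-≤ (suc s) {n = suc n} f≈g = shift-cong-≤ s (f≈g ∘ ℕ.m≤n⇒m≤1+n)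

  shift-*ˡ : ∀ s a f n → shift s (λ m → a * f m) n ≈ a * shift s f n
  shift-*ˡ zero    a f n       = refl
  shift-*ˡ (suc s) a f zero    = sym (zeroʳ a)
  shift-*ˡ (suc s) a f (suc n) = shift-*ˡ s a f n

  ∑-shift : ∀ {A : Set} s (h : A → ℕ) (F : A → Carrier) xs n →
            ∑ (λ t → [ s ℕ.+ h t ≡ᵇ n ]· F t) xs ≈ shift s (λ m → ∑ (λ t → [ h t ≡ᵇ m ]· F t) xs) n
  ∑-shift zero    h F xs n       = refl
  ∑-shift (suc s) h F xs zero    = ∑-zero (λ _ → refl) xs
  ∑-shift (suc s) h F xs (suc n) = ∑-shift s h F xs n

  ∑-upTo-suc : ∀ (h : ℕ → Carrier) n → ∑ h (upTo (suc n)) ≈ ∑ h (upTo n) + h n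
  ∑-upTo-suc h n = begin
    ∑ h (upTo (suc n))         ≡⟨ ≡.cong (∑ h) (upTo-∷ʳ n) ⟨
    ∑ h (upTo n ++ n ∷ [])     ≈⟨ ∑-++ h (upTo n) (n ∷ []) ⟩
    ∑ h (upTo n) + (h n + 0#)  ≈⟨ +-congˡ (+-identityʳ (h n)) ⟩
    ∑ h (upTo n) + h n         ∎

  ∑-upTo-zero : ∀ {h : ℕ → Carrier} n → (∀ {i} → i < n → h i ≈ 0#) → ∑ h (upTo n) ≈ 0#
  ∑-upTo-zero n h≈0 = ∑-zero-local (All.map h≈0 (all-upTo n))

  *ₛ-constS : ∀ (f : Series) a n → (f *ₛ constS a) n ≈ f n * a
  *ₛ-constS f a n = begin
    (f *ₛ constS a) n                                                   ≈⟨ ∑-upTo-suc _ n ⟩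
    ∑ (λ i → f i * constS a (n ℕ.∸ i)) (upTo n) + f n * constS a (n ℕ.∸ n) ≈⟨ +-congʳ (∑-upTo-zero n earlier) ⟩
    0# + f n * constS a (n ℕ.∸ n)                                       ≡⟨ ≡.cong (λ m → 0# + f n * constS a m) (ℕ.n∸n≡0 n) ⟩
    0# + f n * a                                                        ≈⟨ +-identityˡ _ ⟩
    f n * a                                                             ∎
    where
    earlier : ∀ {i} → i < n → f i * constS a (n ℕ.∸ i) ≈ 0#
    earlier {i} i<n = trans (reflexive (≡.cong (λ m → f i * constS a m) (ℕ.+-∸-assoc 1 i<n))) (zeroʳ (f i))

  *ₛ-oneMinus-zero : ∀ (f : Series) b → (f *ₛ oneMinus b) 0 ≈ f 0
  *ₛ-oneMinus-zero f b = trans (+-identityʳ _) (*-identityʳ (f 0))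

  *ₛ-oneMinus-suc : ∀ (f : Series) b n → (f *ₛ oneMinus b) (suc n) ≈ f (suc n) - b * f n
  *ₛ-oneMinus-suc f b n = begin
    (f *ₛ oneMinus b) (suc n)
      ≈⟨ trans (∑-upTo-suc h (suc n)) (+-congʳ (∑-upTo-suc h n)) ⟩
    (∑ h (upTo n) + f n * oneMinus b (suc n ℕ.∸ n)) + f (suc n) * oneMinus b (n ℕ.∸ n)
      ≡⟨ ≡.cong₂ (λ m m' → (∑ h (upTo n) + f n * oneMinus b m) + f (suc n) * oneMinus b m') (ℕ.m+n∸n≡m 1 n) (ℕ.n∸n≡0 n) ⟩
    (∑ h (upTo n) + f n * - b) + f (suc n) * 1#
      ≈⟨ +-cong (+-congʳ (∑-upTo-zero n earlier)) (*-identityʳ _) ⟩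
    (0# + f n * - b) + f (suc n)
      ≈⟨ trans (+-comm _ _) (+-congˡ (trans (+-identityˡ _) (trans (*-comm _ _) (sym (-‿distribˡ-* b (f n)))))) ⟩
    f (suc n) - b * f n
      ∎
    where
    h : ℕ → Carrier
    h i = f i * oneMinus b (suc n ℕ.∸ i)
    earlier : ∀ {i} → i < n → h i ≈ 0#
    earlier {i} i<n = trans (reflexive (≡.cong (λ m → f i * oneMinus b m)
                        (≡.trans (ℕ.+-∸-assoc 1 (ℕ.<⇒≤ i<n)) (≡.cong suc (ℕ.+-∸-assoc 1 i<n))))) (zeroʳ (f i))

  monomial-*ₛ-geom : ∀ a s n → (monomial a s *ₛ geom) n ≈ shift s (λ _ → a) n
  monomial-*ₛ-geom a s n = trans (∑-cong (λ i → trans (*-identityʳ _) (reflexive (≡.cong ([_]· a) (≡ᵇ-comm i s)))) (upTo (suc n)))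
                                 (cases (s ℕ.≤? n))
    where
    cases : Dec (s ≤ n) → ∑ (λ i → [ s ≡ᵇ i ]· a) (upTo (suc n)) ≈ shift s (λ _ → a) n
    cases (yes s≤n) = trans (∑-upTo-δ (λ _ → a) (s≤s s≤n)) (reflexive (≡.sym (shift-≤ s (λ _ → a) s≤n)))
    cases (no  s≰n) = trans (∑-upTo-zero (suc n) (λ i<1+n → reflexive ([]·-false a (λ s≡i →
                        s≰n (ℕ.≤-trans (ℕ.≤-reflexive (ℕ.≡ᵇ⇒≡ s _ s≡i)) (ℕ.≤-pred i<1+n))))))
                            (reflexive (≡.sym (shift-< s (λ _ → a) (ℕ.≰⇒> s≰n))))

  -- the coefficients of (1 - b z) / (1 - z)
  geomOneMinus : Carrier → Series
  geomOneMinus b zero    = 1#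
  geomOneMinus b (suc _) = 1# - b

  shift-geomOneMinus-zero : ∀ a b s → shift s (λ _ → a) 0 ≈ shift s (λ m → a * geomOneMinus b m) 0
  shift-geomOneMinus-zero a b zero    = sym (*-identityʳ a)
  shift-geomOneMinus-zero a b (suc s) = refl

  monomial-geom-oneMinus : ∀ a s b n → ((monomial a s *ₛ geom) *ₛ oneMinus b) n ≈ shift s (λ m → a * geomOneMinus b m) n
  monomial-geom-oneMinus a s b zero    =
    trans (*ₛ-oneMinus-zero (monomial a s *ₛ geom) b) (trans (monomial-*ₛ-geom a s 0) (shift-geomOneMinus-zero a b s))
  monomial-geom-oneMinus a s b (suc n) = begin
    ((monomial a s *ₛ geom) *ₛ oneMinus b) (suc n)
      ≈⟨ *ₛ-oneMinus-suc (monomial a s *ₛ geom) b n ⟩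
    (monomial a s *ₛ geom) (suc n) - b * (monomial a s *ₛ geom) n
      ≈⟨ +-cong (monomial-*ₛ-geom a s (suc n)) (-‿cong (*-congˡ (monomial-*ₛ-geom a s n))) ⟩
    shift s (λ _ → a) (suc n) - b * shift s (λ _ → a) n
      ≈⟨ difference s n ⟩
    shift s (λ m → a * geomOneMinus b m) (suc n)
      ∎
    where
    difference : ∀ s n → shift s (λ _ → a) (suc n) - b * shift s (λ _ → a) n ≈ shift s (λ m → a * geomOneMinus b m) (suc n)
    difference zero    n       = trans (+-cong (sym (*-identityʳ a)) (-‿cong (*-comm b a))) (sym (x[y-z]≈xy-xz a 1# b))
    difference (suc s) zero    = trans (+-congˡ (trans (-‿cong (zeroʳ b)) ε⁻¹≈ε))
                                       (trans (+-identityʳ _) (shift-geomOneMinus-zero a b s))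
    difference (suc s) (suc n) = difference s n

module StripWeights {c ℓ} (R : CommutativeRing c ℓ) (q : CommutativeRing.Carrier R) (mu : List ℕ) where
  import Data.Nat.Base as ℕ
  import Data.Nat.Properties as ℕ
  open import Data.List.Relation.Unary.Any as Any using ()
  open CommutativeRing R hiding (zero)
  open RingDefs R
  open Sums R
  open import Algebra.Properties.CommutativeSemigroup *-commutativeSemigroup using (x∙yz≈y∙xz)
  open import Algebra.Properties.Ring ring using ([y-z]x≈yx-zx)
  open import Relation.Binary.Reasoning.Setoid setoid

  ψ-factor : ℕ → ℕ → ℕ → Carrier
  ψ-factor j a b = if (a ≡ᵇ 0) ∧ (b ≡ᵇ 1) then 1# - pow q (mult mu j) else 1#

  ψ-factor-0 : ∀ j a → ψ-factor j a 0 ≡ 1#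
  ψ-factor-0 j a with a ≡ᵇ 0
  ... | true  = ≡.refl
  ... | false = ≡.refl

  -- The weight of a strip read column by column: t lists θ'_{j+1}, θ'_{j+2}, … and p is θ'_j;
  -- starting from p = 1 at column 0 makes the first factor trivial.
  stripWeight : ℕ → ℕ → List ℕ → Carrier
  stripWeight j p []      = 1#
  stripWeight j p (x ∷ t) = ψ-factor j p x * (pow q (x ℕ.* conj mu (suc j)) * stripWeight (suc j) x t)

  stripWeight-++ : ∀ j p u t → stripWeight j p (u ++ t) ≈ stripWeight j p u * stripWeight (length u ℕ.+ j) (lastOr p u) t
  stripWeight-++ j p []      t = sym (*-identityˡ _)
  stripWeight-++ j p (x ∷ u) t = begin
    ψ-factor j p x * (pow q (x ℕ.* conj mu (suc j)) * stripWeight (suc j) x (u ++ t))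
      ≈⟨ *-congˡ (*-congˡ (stripWeight-++ (suc j) x u t)) ⟩
    ψ-factor j p x * (pow q (x ℕ.* conj mu (suc j)) * (stripWeight (suc j) x u * stripWeight (length u ℕ.+ suc j) (lastOr x u) t))
      ≈⟨ trans (*-congˡ (sym (*-assoc _ _ _))) (sym (*-assoc _ _ _)) ⟩
    stripWeight j p (x ∷ u) * stripWeight (length u ℕ.+ suc j) (lastOr x u) t
      ≡⟨ ≡.cong (λ i → stripWeight j p (x ∷ u) * stripWeight i (lastOr x u) t) (ℕ.+-suc (length u) j) ⟩
    stripWeight j p (x ∷ u) * stripWeight (suc (length u ℕ.+ j)) (lastOr x u) t
      ∎

  stripWeight-map : ∀ (g : ℕ → ℕ) j n → stripWeight j (g j) (map g (range (suc j) n)) ≈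
                    ∏ (λ i → ψ-factor i (g i) (g (suc i))) (range j n) * pow q (sum (map (λ i → g i ℕ.* conj mu i) (range (suc j) n)))
  stripWeight-map g j zero    = sym (*-identityˡ 1#)
  stripWeight-map g j (suc n) = begin
    ψ-factor j (g j) (g (suc j)) * (pow q (g (suc j) ℕ.* conj mu (suc j)) * stripWeight (suc j) (g (suc j)) (map g (range (suc (suc j)) n)))
      ≈⟨ *-congˡ (*-congˡ (stripWeight-map g (suc j) n)) ⟩
    ψ-factor j (g j) (g (suc j)) * (pow q (g (suc j) ℕ.* conj mu (suc j)) * (P * pow q E))
      ≈⟨ trans (*-congˡ (x∙yz≈y∙xz _ P _)) (sym (*-assoc _ _ _)) ⟩
    (ψ-factor j (g j) (g (suc j)) * P) * (pow q (g (suc j) ℕ.* conj mu (suc j)) * pow q E)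
      ≈⟨ *-congˡ (sym (pow-+ q (g (suc j) ℕ.* conj mu (suc j)) E)) ⟩
    (ψ-factor j (g j) (g (suc j)) * P) * pow q (g (suc j) ℕ.* conj mu (suc j) ℕ.+ E)
      ∎
    where
    P = ∏ (λ i → ψ-factor i (g i) (g (suc i))) (range (suc j) n)
    E = sum (map (λ i → g i ℕ.* conj mu i) (range (suc (suc j)) n))

  stripWeight-columns : ∀ (g : ℕ → ℕ) n → stripWeight 0 1 (map g (range 1 (suc n))) ≈
                        ∏ (λ i → ψ-factor i (g i) (g (suc i))) (range 1 n) * pow q (sum (map (λ i → g i ℕ.* conj mu i) (range 1 (suc n))))
  stripWeight-columns g n = begin
    1# * (pow q (g 1 ℕ.* conj mu 1) * stripWeight 1 (g 1) (map g (range 2 n)))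
      ≈⟨ trans (*-identityˡ _) (*-congˡ (stripWeight-map g 1 n)) ⟩
    pow q (g 1 ℕ.* conj mu 1) * (P * pow q E)
      ≈⟨ trans (x∙yz≈y∙xz _ P _) (*-congˡ (sym (pow-+ q (g 1 ℕ.* conj mu 1) E))) ⟩
    P * pow q (g 1 ℕ.* conj mu 1 ℕ.+ E)
      ∎
    where
    P = ∏ (λ i → ψ-factor i (g i) (g (suc i))) (range 1 n)
    E = sum (map (λ i → g i ℕ.* conj mu i) (range 2 n))

  ψ-factor-ascent : ∀ j {a a'} → a ≤ 1 → a' ≤ 1 → conj mu j ℕ.+ a < conj mu (suc j) ℕ.+ a' → ψ-factor j a a' ≈ 0#
  ψ-factor-ascent j a≤1 a'≤1 ascent with bit-ascent (conj-antitone mu (ℕ.n≤1+n j)) a≤1 a'≤1 ascent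
  ... | ≡.refl , ≡.refl , m≡0 = trans (+-congˡ (-‿cong (reflexive (≡.cong (pow q) m≡0)))) (-‿inverseʳ 1#)

  stripWeight-ascent : ∀ b n → length b ≡ suc n → All (_≤ 1) b →
                       ¬ T (decreasingᵇ (map (λ j → conj mu j ℕ.+ part b j) (range 1 (suc n)))) → stripWeight 0 1 b ≈ 0#
  stripWeight-ascent b n len b≤1 ¬dec = begin
    stripWeight 0 1 b                                  ≡⟨ ≡.cong (stripWeight 0 1) (map-part-range b len) ⟨
    stripWeight 0 1 (map (part b) (range 1 (suc n)))   ≈⟨ stripWeight-columns (part b) n ⟩
    P * pow q E                                        ≈⟨ *-congʳ (∏-zero (Any.map (λ {j} → ψ-factor-ascent j (‼-bounded b≤1 _) (‼-bounded b≤1 _))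
                                                                                    (map-range-ascent _ 1 n ¬dec))) ⟩
    0# * pow q E                                       ≈⟨ zeroˡ _ ⟩
    0#                                                 ∎
    where
    P = ∏ (λ i → ψ-factor i (part b i) (part b (suc i))) (range 1 n)
    E = sum (map (λ i → part b i ℕ.* conj mu i) (range 1 (suc n)))

  tailSum : ℕ → ℕ → ℕ → ℕ → Carrier
  tailSum j p L m = ∑ (λ t → [ sum t ≡ᵇ m ]· stripWeight j p t) (lists L 1)

  tailSum-suc : ∀ j p L m → tailSum j p (suc L) m ≈ tailSum (suc j) 0 L m +
                ∑ (λ t → [ suc (sum t) ≡ᵇ m ]· (ψ-factor j p 1 * (pow q (conj mu (suc j)) * stripWeight (suc j) 1 t))) (lists L 1)
  tailSum-suc j p L m = trans (∑-lists-suc _ L 1) (+-cong (∑-cong first (lists L 1)) (trans (+-identityʳ _) (∑-cong second (lists L 1))))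
    where
    first : ∀ t → [ sum t ≡ᵇ m ]· (ψ-factor j p 0 * (1# * stripWeight (suc j) 0 t)) ≈ [ sum t ≡ᵇ m ]· stripWeight (suc j) 0 t
    first t = []·-cong (sum t ≡ᵇ m) (λ _ → trans (*-congʳ (reflexive (ψ-factor-0 j p))) (trans (*-identityˡ _) (*-identityˡ _)))
    second : ∀ t → [ suc (sum t) ≡ᵇ m ]· (ψ-factor j p 1 * (pow q (1 ℕ.* conj mu (suc j)) * stripWeight (suc j) 1 t)) ≈
                   [ suc (sum t) ≡ᵇ m ]· (ψ-factor j p 1 * (pow q (conj mu (suc j)) * stripWeight (suc j) 1 t))
    second t = reflexive (≡.cong (λ e → [ suc (sum t) ≡ᵇ m ]· (ψ-factor j p 1 * (pow q e * stripWeight (suc j) 1 t))) (ℕ.*-identityˡ (conj mu (suc j))))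

  tailSum-suc-zero : ∀ j p L → tailSum j p (suc L) 0 ≈ tailSum (suc j) 0 L 0
  tailSum-suc-zero j p L = trans (tailSum-suc j p L 0) (trans (+-congˡ (∑-zero (λ _ → refl) (lists L 1))) (+-identityʳ _))

  tailSum-suc-suc : ∀ j p L m → tailSum j p (suc L) (suc m) ≈
                    tailSum (suc j) 0 L (suc m) + ψ-factor j p 1 * (pow q (conj mu (suc j)) * tailSum (suc j) 1 L m)
  tailSum-suc-suc j p L m = trans (tailSum-suc j p L (suc m)) (+-congˡ (begin
    ∑ (λ t → [ sum t ≡ᵇ m ]· (ψ-factor j p 1 * (pow q (conj mu (suc j)) * stripWeight (suc j) 1 t))) (lists L 1)
      ≈⟨ ∑-cong (λ t → trans ([]·-*ˡ (sum t ≡ᵇ m) _ _) (*-congˡ ([]·-*ˡ (sum t ≡ᵇ m) _ _))) (lists L 1) ⟩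
    ∑ (λ t → ψ-factor j p 1 * (pow q (conj mu (suc j)) * [ sum t ≡ᵇ m ]· stripWeight (suc j) 1 t)) (lists L 1)
      ≈⟨ trans (∑-*ˡ _ _ (lists L 1)) (*-congˡ (∑-*ˡ _ _ (lists L 1))) ⟩
    ψ-factor j p 1 * (pow q (conj mu (suc j)) * tailSum (suc j) 1 L m)
      ∎))

  tailSum-zero : ∀ L j p → tailSum j p L 0 ≈ 1#
  tailSum-zero zero    j p = +-identityʳ 1#
  tailSum-zero (suc L) j p = trans (tailSum-suc-zero j p L) (tailSum-zero L (suc j) 0)

  tailSum-empty : ∀ {L m} j p → L < m → tailSum j p L m ≈ 0#
  tailSum-empty {L} {m} j p L<m = ∑-zero-local (All.map (λ {t} (len , t≤1) → reflexive ([]·-false (stripWeight j p t) (λ sum≡m →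
    ℕ.<⇒≱ L<m (≡.subst (_≤ L) (ℕ.≡ᵇ⇒≡ (sum t) m sum≡m) (≡.subst (sum t ≤_) len (sum-bits≤length t≤1)))))) (All-lists L 1))

  Vanishes : ℕ → ℕ → ℕ → Set
  Vanishes j L m = ∀ i → j ℕ.+ L < i ℕ.+ m → conj mu i ≡ 0

  Vanishes-suc : ∀ j L m → Vanishes j (suc L) m → Vanishes (suc j) L m
  Vanishes-suc j L m v i j+L<i+m = v i (≡.subst (ℕ._< i ℕ.+ m) (≡.sym (ℕ.+-suc j L)) j+L<i+m)

  Vanishes-pred : ∀ j L m → Vanishes j L (suc m) → Vanishes j L m
  Vanishes-pred j L m v i j+L<i+m = v i (ℕ.<-≤-trans j+L<i+m (ℕ.+-monoʳ-≤ i (ℕ.n≤1+n m)))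

  sub-add : ∀ a b → (a - b) + b ≈ a
  sub-add a b = trans (+-assoc a (- b) b) (trans (+-congˡ (-‿inverseˡ b)) (+-identityʳ a))

  telescope : ∀ a b d → (a - b) + (b - d) ≈ a - d
  telescope a b d = trans (sym (+-assoc (a - b) b (- d))) (+-congʳ (sub-add a b))

  mutual
    tailSum-one : ∀ L j m → m ≤ L → Vanishes j L m → tailSum j 1 L m ≈ 1#
    tailSum-one L       j zero    _         _ = tailSum-zero L j 1
    tailSum-one (suc L) j (suc m) (s≤s m≤L) v = begin
      tailSum j 1 (suc L) (suc m)
        ≈⟨ tailSum-suc-suc j 1 L m ⟩
      tailSum (suc j) 0 L (suc m) + 1# * (pow q (conj mu (suc j)) * tailSum (suc j) 1 L m)
        ≈⟨ +-cong (tailSum-nought L (suc j) m (Vanishes-suc j L (suc m) v))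
                  (trans (*-identityˡ _) (*-congˡ (tailSum-one L (suc j) m m≤L (Vanishes-pred (suc j) L m (Vanishes-suc j L (suc m) v))))) ⟩
      (1# - pow q (conj mu (suc j))) + pow q (conj mu (suc j)) * 1#
        ≈⟨ trans (+-congˡ (*-identityʳ _)) (sub-add 1# _) ⟩
      1#
        ∎

    tailSum-nought : ∀ L j m → Vanishes j L (suc m) → tailSum j 0 L (suc m) ≈ 1# - pow q (conj mu j)
    tailSum-nought zero    j m v = trans (+-identityʳ 0#) (sym (trans (+-congˡ (-‿cong (reflexive (≡.cong (pow q) (v j j+0<j+1+m))))) (-‿inverseʳ 1#)))
      where
      j+0<j+1+m : j ℕ.+ 0 < j ℕ.+ suc m
      j+0<j+1+m = ℕ.+-monoʳ-< j (s≤s z≤n)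
    tailSum-nought (suc L) j m v with m ℕ.≤? L
    ... | yes m≤L = begin
      tailSum j 0 (suc L) (suc m)
        ≈⟨ tailSum-suc-suc j 0 L m ⟩
      tailSum (suc j) 0 L (suc m) + (1# - pow q (mult mu j)) * (pow q (conj mu (suc j)) * tailSum (suc j) 1 L m)
        ≈⟨ +-cong (tailSum-nought L (suc j) m (Vanishes-suc j L (suc m) v))
                  (*-congˡ (trans (*-congˡ (tailSum-one L (suc j) m m≤L (Vanishes-pred (suc j) L m (Vanishes-suc j L (suc m) v)))) (*-identityʳ _))) ⟩
      (1# - pow q (conj mu (suc j))) + (1# - pow q (mult mu j)) * pow q (conj mu (suc j))
        ≈⟨ +-congˡ (trans ([y-z]x≈yx-zx _ 1# _) (+-cong (*-identityˡ _) (-‿cong (sym (pow-+ q (mult mu j) (conj mu (suc j))))))) ⟩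
      (1# - pow q (conj mu (suc j))) + (pow q (conj mu (suc j)) - pow q (mult mu j ℕ.+ conj mu (suc j)))
        ≈⟨ telescope 1# _ _ ⟩
      1# - pow q (mult mu j ℕ.+ conj mu (suc j))
        ≡⟨ ≡.cong (λ e → 1# - pow q e) (ℕ.m∸n+n≡m (conj-antitone mu (ℕ.n≤1+n j))) ⟩
      1# - pow q (conj mu j)
        ∎
    ... | no m≰L = begin
      tailSum j 0 (suc L) (suc m)
        ≈⟨ tailSum-suc-suc j 0 L m ⟩
      tailSum (suc j) 0 L (suc m) + (1# - pow q (mult mu j)) * (pow q (conj mu (suc j)) * tailSum (suc j) 1 L m)
        ≈⟨ +-cong (tailSum-empty (suc j) 0 (ℕ.m≤n⇒m≤1+n L<m)) (trans (*-congˡ (trans (*-congˡ (tailSum-empty (suc j) 1 L<m)) (zeroʳ _))) (zeroʳ _)) ⟩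
      0# + 0#
        ≈⟨ +-identityʳ 0# ⟩
      0#
        ≈⟨ -‿inverseʳ 1# ⟨
      1# - 1#
        ≡⟨ ≡.cong (λ e → 1# - pow q e) (v j j+1+L<j+1+m) ⟨
      1# - pow q (conj mu j)
        ∎
      where
      L<m : L < m
      L<m = ℕ.≰⇒> m≰L
      j+1+L<j+1+m : j ℕ.+ suc L < j ℕ.+ suc m
      j+1+L<j+1+m = ℕ.+-monoʳ-< j (s≤s L<m)

module Coefficient {c ℓ} (R : CommutativeRing c ℓ) (q : CommutativeRing.Carrier R)
                   {mu : List ℕ} (dμ : Decreasing mu) {k' : ℕ} (ω : Vec Bool (suc k')) (N : ℕ) where
  import Data.Nat.Base as ℕ
  import Data.Nat.Properties as ℕ
  open import Data.Nat.ListAction.Properties using (sum-++)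
  open CommutativeRing R hiding (zero)
  open RingDefs R
  open Sums R
  open PowerSeries R
  open StripWeights R q mu
  open Bijection dμ ω N
  open import Algebra.Properties.CommutativeSemigroup *-commutativeSemigroup using (x∙yz≈xz∙y; xy∙z≈xz∙y)
  open import Algebra.Properties.Group +-group using (ε⁻¹≈ε)
  open import Relation.Binary.Reasoning.Setoid setoid

  weight : List ℕ → Carrier
  weight la = pow q (nfun la) * ψ q la mu

  weight-columns : ∀ {la} → InLists M M la → T (Valid la) → weight la ≈ pow q (nfun mu) * stripWeight 0 1 (columns la)
  weight-columns {la} la∈ valid = begin
    pow q (nfun la) * ψ q la mu                   ≈⟨ *-cong (reflexive (≡.cong (pow q) nfun-columns)) ψ-columns ⟩
    pow q (nfun mu ℕ.+ E) * P                     ≈⟨ *-congʳ (pow-+ q (nfun mu) E) ⟩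
    (pow q (nfun mu) * pow q E) * P               ≈⟨ trans (*-assoc _ _ _) (*-congˡ (*-comm _ _)) ⟩
    pow q (nfun mu) * (P * pow q E)               ≈⟨ *-congˡ (stripWeight-columns (θ' mu la) (k' ℕ.+ M)) ⟨
    pow q (nfun mu) * stripWeight 0 1 (columns la) ∎
    where
    open Columns {la} la∈ valid
    f : ℕ → Carrier
    f j = ψ-factor j (θ' mu la j) (θ' mu la (suc j))
    P = ∏ f (range 1 (k' ℕ.+ M))
    E = sum (map (λ j → θ' mu la j ℕ.* conj mu j) (range 1 K))
    trivial : ∀ {j} → M ≤ j → f j ≈ 1#
    trivial {j} M≤j = reflexive (≡.trans (≡.cong (ψ-factor j (θ' mu la j)) (θ'-vanishes M≤j)) (ψ-factor-0 j (θ' mu la j)))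
    ψ-columns : ψ q la mu ≈ P
    ψ-columns = begin
      ∏ f (range1 (bound mu la))     ≡⟨ ≡.cong (∏ f) (range1≡range (bound mu la)) ⟩
      ∏ f (range 1 (bound mu la))    ≈⟨ ∏-truncate M (bound mu la) M≤bound trivial ⟩
      ∏ f (range 1 M)                ≈⟨ ∏-truncate M (k' ℕ.+ M) (ℕ.m≤n+m M k') trivial ⟨
      P                              ∎
      where
      M≤bound : M ≤ bound mu la
      M≤bound = ℕ.≤-trans (ℕ.≤-reflexive (≡.sym size≡M)) (ℕ.≤-trans (ℕ.m≤n+m (size la) (size mu)) (size≤bound mu la))

  lhs-columns : lhs q k ω mu N ≈ ∑ (λ b → [ Admissible b ]· (pow q (nfun mu) * stripWeight 0 1 b)) (lists K 1)
  lhs-columns = begin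
    ∑ (λ la → [ Valid la ]· weight la) (lists M M)             ≈⟨ ∑-reindex (≡-dec ℕ._≟_) (≡-dec ℕ._≟_) columns shape weight forward backward ⟩
    ∑ (λ b → [ Admissible b ]· weight (shape b)) (lists K 1)   ≈⟨ ∑-cong-local (All.map (λ {b} b∈ → []·-cong (Admissible b) (weight-shape b∈)) (All-lists K 1)) ⟩
    ∑ (λ b → [ Admissible b ]· (pow q (nfun mu) * stripWeight 0 1 b)) (lists K 1) ∎
    where
    forward : All (λ la → T (Valid la) → CountsOnce (≡-dec ℕ._≟_) (lists K 1) (columns la) ×
                                           T (Admissible (columns la)) × shape (columns la) ≡ la) (lists M M)
    forward = All.map (λ la∈ valid → let columns∈ , admissible , inverse = columns-inverse la∈ valid in
                        lists-counts-once columns∈ , admissible , inverse) (All-lists M M)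
    backward : All (λ b → T (Admissible b) → CountsOnce (≡-dec ℕ._≟_) (lists M M) (shape b) ×
                                              T (Valid (shape b)) × columns (shape b) ≡ b) (lists K 1)
    backward = All.map (λ b∈ adm → let shape∈ , valid , inverse = shape-inverse b∈ adm in
                         lists-counts-once shape∈ , valid , inverse) (All-lists K 1)
    weight-shape : ∀ {b} → InLists K 1 b → T (Admissible b) → weight (shape b) ≈ pow q (nfun mu) * stripWeight 0 1 b
    weight-shape b∈ adm = let shape∈ , valid , inverse = shape-inverse b∈ adm in
      trans (weight-columns shape∈ valid) (reflexive (≡.cong (λ t → pow q (nfun mu) * stripWeight 0 1 t) inverse))

  ωₖ : ℕ
  ωₖ = ωat ω k

  β : Carrier
  β = (1# - (if ωₖ ≡ᵇ 1 then 1# else 0#)) * pow q (conj mu k)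

  s : ℕ
  s = sum (map (ωat ω) (range1 k))

  Eω : ℕ
  Eω = sum (map (λ i → conj mu i ℕ.* ωat ω i) (range1 k))

  Pω : Carrier
  Pω = ∏ (λ j → ψ-factor j (ωat ω j) (ωat ω (suc j))) (range1 k')

  tail-vanishes : ∀ {m} → m ≤ N → Vanishes k M m
  tail-vanishes {m} m≤N i k+M<i+m = conj-vanishes (All-≤-size mu)
    (ℕ.+-cancelʳ-< N (size mu) i (ℕ.≤-<-trans (ℕ.m≤n+m M k) (ℕ.<-≤-trans k+M<i+m (ℕ.+-monoʳ-≤ i m≤N))))

  tailSum≈geomOneMinus : ∀ p → p ≤ 1 → ∀ {m} → m ≤ N →
                         tailSum k p M m ≈ geomOneMinus ((1# - (if p ≡ᵇ 1 then 1# else 0#)) * pow q (conj mu k)) m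
  tailSum≈geomOneMinus p             _        {zero}  _   = tailSum-zero M k p
  tailSum≈geomOneMinus zero          _        {suc m} m<N = trans (tailSum-nought M k m (tail-vanishes m<N))
    (+-congˡ (-‿cong (sym (trans (*-congʳ (trans (+-congˡ ε⁻¹≈ε) (+-identityʳ 1#))) (*-identityˡ _)))))
  tailSum≈geomOneMinus (suc zero)    _        {suc m} m<N =
    trans (tailSum-one M k (suc m) (ℕ.≤-trans m<N (ℕ.m≤n+m N (size mu))) (tail-vanishes m<N))
          (sym (trans (+-congˡ (trans (-‿cong (trans (*-congʳ (-‿inverseʳ 1#)) (zeroˡ _))) ε⁻¹≈ε)) (+-identityʳ 1#)))
  tailSum≈geomOneMinus (suc (suc _)) (s≤s ()) {suc _} _

  sum-ω̂ : sum ω̂ ≡ s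
  sum-ω̂ = ≡.sym (≡.cong sum (≡.trans (≡.cong (map (ωat ω)) (range1≡range k))
            (≡.trans (map-cong-range1 k (λ t → ≡.refl)) (map-part-range ω̂ length-ω̂))))

  stripWeight-ω̂ : stripWeight 0 1 ω̂ ≈ Pω * pow q Eω
  stripWeight-ω̂ = begin
    stripWeight 0 1 ω̂                               ≡⟨ ≡.cong (stripWeight 0 1) (map-part-range ω̂ length-ω̂) ⟨
    stripWeight 0 1 (map (part ω̂) (range 1 k))     ≈⟨ stripWeight-columns (part ω̂) k' ⟩
    ∏ (λ i → ψ-factor i (part ω̂ i) (part ω̂ (suc i))) (range 1 k') * pow q (sum (map (λ i → part ω̂ i ℕ.* conj mu i) (range 1 k)))
                                                     ≡⟨ ≡.cong₂ (λ P E → P * pow q E) factors exponent ⟩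
    Pω * pow q Eω                                    ∎
    where
    factors : ∏ (λ i → ψ-factor i (part ω̂ i) (part ω̂ (suc i))) (range 1 k') ≡ Pω
    factors = ≡.trans (≡.cong prodR (map-cong-range1 k' (λ t → ≡.refl)))
                      (≡.cong (∏ (λ j → ψ-factor j (ωat ω j) (ωat ω (suc j)))) (≡.sym (range1≡range k')))
    exponent : sum (map (λ i → part ω̂ i ℕ.* conj mu i) (range 1 k)) ≡ Eω
    exponent = ≡.trans (≡.cong sum (map-cong-range1 k (λ t → ℕ.*-comm (ω̂ ‼ t) (conj mu (suc t)))))
                       (≡.cong (λ r → sum (map (λ i → conj mu i ℕ.* ωat ω i) r)) (≡.sym (range1≡range k)))

  contribution : List ℕ → Carrier
  contribution b = [ sum b ≡ᵇ N ]· (pow q (nfun mu) * stripWeight 0 1 b)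

  -- The condition that the profile μ' + b be a partition can be dropped (stripWeight-ascent).
  lhs-prefix : lhs q k ω mu N ≈ ∑ (λ t → contribution (ω̂ ++ t)) (lists M 1)
  lhs-prefix = begin
    lhs q k ω mu N                                                              ≈⟨ lhs-columns ⟩
    ∑ (λ b → [ Admissible b ]· (pow q (nfun mu) * stripWeight 0 1 b)) (lists K 1) ≈⟨ ∑-cong-local (All.map drop-decreasing (All-lists K 1)) ⟩
    ∑ (λ b → [ ω̂ ≼ᵇ b ]· contribution b) (lists K 1)                           ≈⟨ prefix ⟩
    ∑ (λ t → contribution (ω̂ ++ t)) (lists M 1)                                ∎
    where
    prefix : ∑ (λ b → [ ω̂ ≼ᵇ b ]· contribution b) (lists K 1) ≈ ∑ (λ t → contribution (ω̂ ++ t)) (lists M 1)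
    prefix = ≡.subst (λ n → ∑ (λ b → [ ω̂ ≼ᵇ b ]· contribution b) (lists (n ℕ.+ M) 1) ≈ ∑ (λ t → contribution (ω̂ ++ t)) (lists M 1))
                     length-ω̂ (∑-lists-prefix ω̂ ω̂-bits contribution)
    drop-decreasing : ∀ {b} → InLists K 1 b → [ Admissible b ]· (pow q (nfun mu) * stripWeight 0 1 b) ≈ [ ω̂ ≼ᵇ b ]· contribution b
    drop-decreasing {b} (len , bits) = begin
      [ Admissible b ]· (pow q (nfun mu) * stripWeight 0 1 b)
        ≡⟨ ≡.trans ([]·-∧ (ω̂ ≼ᵇ b) _ _) (≡.cong ([ ω̂ ≼ᵇ b ]·_) ([]·-∧ (sum b ≡ᵇ N) _ _)) ⟩
      [ ω̂ ≼ᵇ b ]· [ sum b ≡ᵇ N ]· [ decreasingᵇ (profile b) ]· (pow q (nfun mu) * stripWeight 0 1 b)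
        ≈⟨ []·-cong (ω̂ ≼ᵇ b) (λ _ → []·-cong (sum b ≡ᵇ N) (λ _ → []·-redundant (decreasingᵇ (profile b))
             (λ ¬dec → trans (*-congˡ (stripWeight-ascent b (k' ℕ.+ M) len bits ¬dec)) (zeroʳ _)))) ⟩
      [ ω̂ ≼ᵇ b ]· contribution b
        ∎

  lhs-tail : lhs q k ω mu N ≈ (pow q (nfun mu) * stripWeight 0 1 ω̂) * shift s (tailSum k ωₖ M) N
  lhs-tail = begin
    lhs q k ω mu N                                                         ≈⟨ lhs-prefix ⟩
    ∑ (λ t → contribution (ω̂ ++ t)) (lists M 1)                           ≈⟨ ∑-cong split (lists M 1) ⟩
    ∑ (λ t → [ s ℕ.+ sum t ≡ᵇ N ]· (C * stripWeight k ωₖ t)) (lists M 1)   ≈⟨ ∑-shift s sum (λ t → C * stripWeight k ωₖ t) (lists M 1) N ⟩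
    shift s (λ m → ∑ (λ t → [ sum t ≡ᵇ m ]· (C * stripWeight k ωₖ t)) (lists M 1)) N
                                                                           ≈⟨ shift-cong-≤ s (λ {m} _ → trans (∑-cong (λ t → []·-*ˡ (sum t ≡ᵇ m) C _) (lists M 1))
                                                                                                              (∑-*ˡ C _ (lists M 1))) ⟩
    shift s (λ m → C * tailSum k ωₖ M m) N                                 ≈⟨ shift-*ˡ s C (tailSum k ωₖ M) N ⟩
    C * shift s (tailSum k ωₖ M) N                                         ∎
    where
    C = pow q (nfun mu) * stripWeight 0 1 ω̂
    split : ∀ t → contribution (ω̂ ++ t) ≈ [ s ℕ.+ sum t ≡ᵇ N ]· (C * stripWeight k ωₖ t)
    split t = trans ([]·-cong (sum (ω̂ ++ t) ≡ᵇ N) (λ _ → trans (*-congˡ (stripWeight-++ 0 1 ω̂ t)) (sym (*-assoc _ _ _))))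
      (reflexive (≡.cong₂ (λ n w → [ n ≡ᵇ N ]· (C * w))
                          (≡.trans (sum-++ ω̂ t) (≡.cong (ℕ._+ sum t) sum-ω̂))
                          (≡.cong₂ (λ i p → stripWeight i p t) (≡.trans (ℕ.+-identityʳ _) length-ω̂) (lastOr-‼ 1 ω̂ length-ω̂))))

  rhs-tail : rhs q k ω mu N ≈ (pow q (nfun mu ℕ.+ Eω) * shift s (geomOneMinus β) N) * Pω
  rhs-tail = begin
    rhs q k ω mu N                                                             ≈⟨ *ₛ-constS _ Pω N ⟩
    ((monomial (pow q (nfun mu ℕ.+ Eω)) s *ₛ geom) *ₛ oneMinus β) N * Pω      ≈⟨ *-congʳ (monomial-geom-oneMinus _ s β N) ⟩
    shift s (λ m → pow q (nfun mu ℕ.+ Eω) * geomOneMinus β m) N * Pω          ≈⟨ *-congʳ (shift-*ˡ s _ (geomOneMinus β) N) ⟩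
    (pow q (nfun mu ℕ.+ Eω) * shift s (geomOneMinus β) N) * Pω                ∎

  coefficient : lhs q k ω mu N ≈ rhs q k ω mu N
  coefficient = begin
    lhs q k ω mu N                                                ≈⟨ lhs-tail ⟩
    (pow q (nfun mu) * stripWeight 0 1 ω̂) * shift s (tailSum k ωₖ M) N
                                                                  ≈⟨ *-cong (*-congˡ stripWeight-ω̂) (shift-cong-≤ s (tailSum≈geomOneMinus ωₖ (‼-bounded ω̂-bits k'))) ⟩
    (pow q (nfun mu) * (Pω * pow q Eω)) * shift s (geomOneMinus β) N
                                                                  ≈⟨ trans (*-congʳ (x∙yz≈xz∙y _ Pω (pow q Eω))) (xy∙z≈xz∙y _ Pω _) ⟩
    ((pow q (nfun mu) * pow q Eω) * shift s (geomOneMinus β) N) * Pω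
                                                                  ≈⟨ *-congʳ (*-congʳ (pow-+ q (nfun mu) Eω)) ⟨
    (pow q (nfun mu ℕ.+ Eω) * shift s (geomOneMinus β) N) * Pω    ≈⟨ rhs-tail ⟨
    rhs q k ω mu N                                                ∎

lemma4p1 : ∀ {c ℓ : Level} (R : CommutativeRing c ℓ) (q : CommutativeRing.Carrier R)
             (k : ℕ) → 1 ≤ k → (ω : Vec Bool k) (mu : List ℕ) → IsPartition mu →
             RingDefs._≈ₛ_ R (RingDefs.lhs R q k ω mu) (RingDefs.rhs R q k ω mu)
lemma4p1 R q zero    ()
lemma4p1 R q (suc k') _  ω mu dμ N = Coefficient.coefficient R q dμ ω N
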